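{- As $n\to\infty$, $$\left(\tfrac16-o(1)\right)\binom{n}{\lfloor\frac{n+2}{3}\rfloor,\lfloor\frac{n+1}{3}\rfloor,\lfloor\frac{n}{3}\rfloor}2^{s(n)} < T(n) < 3^n2^{s(n)}.$$ In addition (for all sufficiently large $n$), $$T(n-2) < \left(n^2\,2^{ -\frac{2n^2}{9}+n}\right)T(n).$$
   Context: A $3$-graph on $[n]$ is a set of $3$-element subsets of $[n]$; it is $3$-partite if $[n]$ can be partitioned into three parts so that every edge has exactly one vertex in each part. $T(n)$ is the number of $3$-partite $3$-graphs on vertex set $[n]$, and $s(n)=\lfloor n/3\rfloor\lfloor (n+1)/3\rfloor\lfloor (n+2)/3\rfloor$. $\binom{n}{a,b,c}=\frac{n!}{a!b!c!}$ is the multinomial coefficient. -}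

module Defs where

open import Data.Bool using (Bool; true; false; _∧_; _∨_; if_then_else_)
open import Data.Nat using (ℕ; zero; suc; _+_; _*_; _∸_; _^_; _/_; _≡ᵇ_)
open import Data.Nat.Properties using (_!≢0; m*n≢0)
open import Data.Nat using (_!)
open import Data.Fin using (Fin)
open import Data.Fin.Subset using (Subset; ∣_∣)
open import Data.Vec using (Vec; []; _∷_; zipWith; foldr)
open import Data.List using (List; []; _∷_; length; filter; map; concatMap; _++_; allFin)
open import Relation.Nullary.Decidable using (does)
open import Data.Bool.ListAction using (all; any)
open import Data.Fin.Properties using () renaming (_≟_ to _≟F_)
open import Relation.Binary.PropositionalEquality using (_≡_)
open import Data.Nat.Properties using () renaming (_≟_ to _≟ℕ_)

allSubsets : (n : ℕ) → List (Subset n)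
allSubsets zero    = [] ∷ []
allSubsets (suc n) = map (true ∷_) (allSubsets n) ++ map (false ∷_) (allSubsets n)

threeSets : (n : ℕ) → List (Subset n)
threeSets n = filter (λ s → ∣ s ∣ ≟ℕ 3) (allSubsets n)

-- All sublists (sub-multisets respecting order) of a list; applied to a
-- duplicate-free list this enumerates each of its subsets exactly once.
sublists : {A : Set} → List A → List (List A)
sublists []       = [] ∷ []
sublists (x ∷ xs) = map (x ∷_) (sublists xs) ++ sublists xs

-- A 3-graph on [n]: a set of 3-element subsets of [n], represented as a
-- (duplicate-free) list of 3-element subsets.  All 3-graphs on [n]:
threeGraphs : (n : ℕ) → List (List (Subset n))
threeGraphs n = sublists (threeSets n)

-- All maps [n] → {0,1,2} (assignments of vertices to three parts).
allColourings : (n : ℕ) → List (Vec (Fin 3) n)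
allColourings zero    = [] ∷ []
allColourings (suc n) = concatMap (λ c → map (c ∷_) (allColourings n)) (allFin 3)

countIn : {n : ℕ} → Vec (Fin 3) n → Subset n → Fin 3 → ℕ
countIn []      []       k = 0
countIn (c ∷ cs) (b ∷ bs) k =
  (if b ∧ does (c ≟F k) then 1 else 0) + countIn cs bs k

rainbow : {n : ℕ} → Vec (Fin 3) n → Subset n → Bool
rainbow c e = all (λ k → countIn c e k ≡ᵇ 1) (allFin 3)

isTripartite : {n : ℕ} → List (Subset n) → Bool
isTripartite {n} G = any (λ c → all (rainbow c) G) (allColourings n)

T : ℕ → ℕ
T n = length (filter (λ G → isTripartite G Data.Bool.≟ true) (threeGraphs n))

s : ℕ → ℕ
s n = (n / 3) * ((n + 1) / 3) * ((n + 2) / 3)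

multinomial : ℕ → ℕ → ℕ → ℕ → ℕ
multinomial n a b c = (n !) / ((a !) * (b !) * (c !))
  where instance
    _ = m*n≢0 (a ! * b !) (c !) {{m*n≢0 (a !) (b !) {{a !≢0}} {{b !≢0}}}} {{c !≢0}}

M : ℕ → ℕ
M n = multinomial n ((n + 2) / 3) ((n + 1) / 3) (n / 3)

-- Every tripartite 3-graph is properly coloured by one of the 3^n
-- colourings c : [n] → {0,1,2} (it consists of rainbow edges of c), and c has
-- |c⁻¹0|·|c⁻¹1|·|c⁻¹2| ≤ s(n) rainbow edges (AM-GM for integers), so
-- T(n) < 3^n 2^s(n); strictly, since the empty 3-graph is counted 3^n times.
--
-- Call G good for c if c properly colours G and any two vertices in
-- different parts of c share an edge.  Such a G determines c up to the 6
-- permutations of the colours (rigidity).  For a balanced colouring c (parts of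
-- sizes ⌈n/3⌉, …, ⌊n/3⌋; there are M(n) of them) a union bound over the n² pairs
-- shows that all but an n² 2^-⌊n/3⌋ fraction of the 2^s(n) properly coloured
-- 3-graphs are good, so double counting gives
--     2^⌊n/3⌋ M(n) 2^s(n) ≤ 2^⌊n/3⌋ · 6 T(n) + n² M(n) 2^s(n).
-- This yields (1/6 − ε) M(n) 2^s(n) < T(n) eventually, and M(n) 2^s(n) ≤ 12 T(n).
--
-- Combining T(n−2) < 3^(n−2) 2^s(n−2), 3^n ≤ 9 (n+1)² M(n) and
-- 9 s(n−2) + 2n² ≤ 9 s(n) + 8n gives T(n−2)^9 2^(2n²) ≤ (12 (n+1)²)^9 2^(8n) T(n)^9,
-- which is eventually below n^18 2^(9n) T(n)^9.
module Submission where

module FiniteSums where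

  open import Data.Bool using (Bool; true; false; _∧_; not) renaming (T to True)
  open import Data.Nat
  open import Data.Nat.Properties
  open import Data.List using (List; []; _∷_; length; filter; map; concatMap; _++_)
  open import Data.List.Membership.Propositional using (_∈_)
  open import Data.List.Relation.Unary.Any using (here; there)
  open import Data.List.Membership.Propositional.Properties using (∈-++⁺ʳ)
  open import Data.Bool.ListAction using (all; any)
  open import Relation.Nullary.Decidable using (does)
  open import Relation.Nullary using (¬_)
  open import Data.Empty using (⊥-elim)
  open import Relation.Unary using (Pred; Decidable)
  open import Relation.Binary.PropositionalEquality
  open import Function using (_∘_)
  open import Data.Nat.Tactic.RingSolver using (solve-∀)
  open import Defs using (sublists)

  private variable A B : Set

  𝟙 : Bool → ℕ
  𝟙 true  = 1
  𝟙 false = 0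

  𝟙-∧ : ∀ a b → 𝟙 (a ∧ b) ≡ 𝟙 a * 𝟙 b
  𝟙-∧ true  b = sym (+-identityʳ (𝟙 b))
  𝟙-∧ false b = refl

  𝟙≤1 : ∀ a → 𝟙 a ≤ 1
  𝟙≤1 true  = ≤-refl
  𝟙≤1 false = z≤n

  𝟙-∧≤ʳ : ∀ a b → 𝟙 (a ∧ b) ≤ 𝟙 b
  𝟙-∧≤ʳ true  b = ≤-refl
  𝟙-∧≤ʳ false b = z≤n

  𝟙-false : ∀ b → ¬ True b → 𝟙 b ≡ 0
  𝟙-false true  ¬b = ⊥-elim (¬b _)
  𝟙-false false ¬b = refl

  𝟙≤ : ∀ b {m} → (True b → 1 ≤ m) → 𝟙 b ≤ m
  𝟙≤ true  h = h _
  𝟙≤ false h = z≤n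

  𝟙*-mono : ∀ b {x y} → (True b → x ≤ y) → 𝟙 b * x ≤ 𝟙 b * y
  𝟙*-mono true  h = +-monoˡ-≤ 0 (h _)
  𝟙*-mono false h = z≤n

  ∑ : List A → (A → ℕ) → ℕ
  ∑ []       f = 0
  ∑ (x ∷ xs) f = f x + ∑ xs f

  ∑-++ : ∀ (xs ys : List A) f → ∑ (xs ++ ys) f ≡ ∑ xs f + ∑ ys f
  ∑-++ []       ys f = refl
  ∑-++ (x ∷ xs) ys f = trans (cong (f x +_) (∑-++ xs ys f)) (sym (+-assoc (f x) _ _))

  ∑-map : ∀ (g : B → A) (xs : List B) f → ∑ (map g xs) f ≡ ∑ xs (f ∘ g)
  ∑-map g []       f = refl
  ∑-map g (x ∷ xs) f = cong (f (g x) +_) (∑-map g xs f)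

  ∑-concatMap : ∀ (g : B → List A) (xs : List B) f → ∑ (concatMap g xs) f ≡ ∑ xs (λ x → ∑ (g x) f)
  ∑-concatMap g []       f = refl
  ∑-concatMap g (x ∷ xs) f = trans (∑-++ (g x) (concatMap g xs) f) (cong (∑ (g x) f +_) (∑-concatMap g xs f))

  ∑-cong : ∀ (xs : List A) {f g : A → ℕ} → (∀ x → f x ≡ g x) → ∑ xs f ≡ ∑ xs g
  ∑-cong []       e = refl
  ∑-cong (x ∷ xs) e = cong₂ _+_ (e x) (∑-cong xs e)

  ∑-mono : ∀ (xs : List A) {f g : A → ℕ} → (∀ x → f x ≤ g x) → ∑ xs f ≤ ∑ xs g
  ∑-mono []       e = z≤n
  ∑-mono (x ∷ xs) e = +-mono-≤ (e x) (∑-mono xs e)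

  ∑-mono-< : ∀ (xs : List A) {f g : A → ℕ} → (∀ x → f x ≤ g x) →
    ∀ {y} → y ∈ xs → f y < g y → ∑ xs f < ∑ xs g
  ∑-mono-< (x ∷ xs) e (here refl) lt = +-mono-<-≤ lt (∑-mono xs e)
  ∑-mono-< (x ∷ xs) e (there y∈) lt = +-mono-≤-< (e x) (∑-mono-< xs e y∈ lt)

  ∑-member : ∀ (xs : List A) f {x} → x ∈ xs → f x ≤ ∑ xs f
  ∑-member (y ∷ xs) f (here refl) = m≤m+n _ _
  ∑-member (y ∷ xs) f (there x∈) = ≤-trans (∑-member xs f x∈) (m≤n+m _ _)

  ∑-+ : ∀ (xs : List A) f g → ∑ xs (λ x → f x + g x) ≡ ∑ xs f + ∑ xs g
  ∑-+ []       f g = refl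
  ∑-+ (x ∷ xs) f g = trans (cong (f x + g x +_) (∑-+ xs f g)) (swap (f x) (g x) (∑ xs f) (∑ xs g))
    where swap : ∀ a b c d → a + b + (c + d) ≡ a + c + (b + d)
          swap = solve-∀

  ∑-*ˡ : ∀ (xs : List A) k f → ∑ xs (λ x → k * f x) ≡ k * ∑ xs f
  ∑-*ˡ []       k f = sym (*-zeroʳ k)
  ∑-*ˡ (x ∷ xs) k f = trans (cong (k * f x +_) (∑-*ˡ xs k f)) (sym (*-distribˡ-+ k (f x) _))

  ∑-*ʳ : ∀ (xs : List A) f k → ∑ xs (λ x → f x * k) ≡ ∑ xs f * k
  ∑-*ʳ []       f k = refl
  ∑-*ʳ (x ∷ xs) f k = trans (cong (f x * k +_) (∑-*ʳ xs f k)) (sym (*-distribʳ-+ k (f x) _))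

  ∑-const : ∀ (xs : List A) k → ∑ xs (λ _ → k) ≡ length xs * k
  ∑-const []       k = refl
  ∑-const (x ∷ xs) k = cong (k +_) (∑-const xs k)

  ∑-zero : ∀ (xs : List A) {f} → (∀ x → f x ≡ 0) → ∑ xs f ≡ 0
  ∑-zero xs {f} e = trans (∑-cong xs e) (trans (∑-const xs 0) (*-zeroʳ (length xs)))

  ∑-swap : ∀ (xs : List A) (ys : List B) (f : A → B → ℕ) →
    ∑ xs (λ x → ∑ ys (f x)) ≡ ∑ ys (λ y → ∑ xs (λ x → f x y))
  ∑-swap []       ys f = sym (∑-zero ys (λ _ → refl))
  ∑-swap (x ∷ xs) ys f =
    trans (cong (∑ ys (f x) +_) (∑-swap xs ys f)) (sym (∑-+ ys (f x) (λ y → ∑ xs (λ x → f x y))))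

  length-filter : ∀ {ℓ} {P : Pred A ℓ} (P? : Decidable P) (xs : List A) →
    length (filter P? xs) ≡ ∑ xs (𝟙 ∘ does ∘ P?)
  length-filter P? [] = refl
  length-filter P? (x ∷ xs) with does (P? x)
  ... | true  = cong suc (length-filter P? xs)
  ... | false = length-filter P? xs

  ∑-filter : ∀ {ℓ} {P : Pred A ℓ} (P? : Decidable P) (xs : List A) f →
    ∑ (filter P? xs) f ≡ ∑ xs (λ x → 𝟙 (does (P? x)) * f x)
  ∑-filter P? [] f = refl
  ∑-filter P? (x ∷ xs) f with does (P? x)
  ... | true  = cong₂ _+_ (sym (+-identityʳ (f x))) (∑-filter P? xs f)
  ... | false = ∑-filter P? xs f

  sublists-all : ∀ (p : A → Bool) (L : List A) →
    ∑ (sublists L) (𝟙 ∘ all p) ≡ 2 ^ ∑ L (𝟙 ∘ p)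
  sublists-all p [] = refl
  sublists-all p (x ∷ L) = begin
    ∑ (map (x ∷_) (sublists L) ++ sublists L) (𝟙 ∘ all p)
      ≡⟨ ∑-++ (map (x ∷_) (sublists L)) (sublists L) _ ⟩
    ∑ (map (x ∷_) (sublists L)) (𝟙 ∘ all p) + ∑ (sublists L) (𝟙 ∘ all p)
      ≡⟨ cong₂ _+_ (∑-map (x ∷_) (sublists L) _) (sublists-all p L) ⟩
    ∑ (sublists L) (λ G → 𝟙 (p x ∧ all p G)) + 2 ^ k
      ≡⟨ cong (_+ 2 ^ k) (split (p x)) ⟩
    𝟙 (p x) * 2 ^ k + 2 ^ k
      ≡⟨ double (p x) ⟩
    2 ^ (𝟙 (p x) + k) ∎
    where
    open ≡-Reasoning
    k : ℕ
    k = ∑ L (𝟙 ∘ p)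
    split : ∀ b → ∑ (sublists L) (λ G → 𝟙 (b ∧ all p G)) ≡ 𝟙 b * 2 ^ k
    split true  = trans (sublists-all p L) (sym (+-identityʳ (2 ^ k)))
    split false = ∑-zero (sublists L) (λ _ → refl)
    double : ∀ b → 𝟙 b * 2 ^ k + 2 ^ k ≡ 2 ^ (𝟙 b + k)
    double true  = twice (2 ^ k)
      where twice : ∀ x → 1 * x + x ≡ 2 * x
            twice = solve-∀
    double false = refl

  []∈sublists : ∀ (L : List A) → [] ∈ sublists L
  []∈sublists []      = here refl
  []∈sublists (x ∷ L) = ∈-++⁺ʳ (map (x ∷_) (sublists L)) ([]∈sublists L)

  union-bound : ∀ {I : Set} (a : Bool) (q : I → Bool) (is : List I) →
    𝟙 a ≤ 𝟙 (a ∧ all q is) + ∑ is (λ i → 𝟙 (a ∧ not (q i)))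
  union-bound false q is = z≤n
  union-bound true  q [] = ≤-refl
  union-bound true  q (i ∷ is) with q i
  ... | true  = union-bound true q is
  ... | false = ≤-trans (s≤s z≤n) (m≤n+m (suc _) (𝟙 (false ∧ all q is)))

  𝟙-any≤∑ : ∀ (q : A → Bool) (xs : List A) → 𝟙 (any q xs) ≤ ∑ xs (𝟙 ∘ q)
  𝟙-any≤∑ q [] = z≤n
  𝟙-any≤∑ q (x ∷ xs) with q x
  ... | true  = s≤s z≤n
  ... | false = 𝟙-any≤∑ q xs

module Colourings where

  open import Data.Bool using (Bool; _∧_; if_then_else_)
  open import Data.Bool.Properties using (∧-zeroʳ)
  open import Data.Nat
  open import Data.Nat.Properties
  open import Data.Fin using (Fin; zero; suc)
  open import Data.Fin.Properties using () renaming (_≟_ to _≟F_)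
  open import Data.Vec using (Vec; []; _∷_)
  open import Data.Vec.Properties using (≡-dec)
  open import Data.List using (List; []; _∷_; map; allFin)
  open import Data.List.Membership.Propositional using (_∈_)
  open import Data.List.Relation.Unary.Any using (here)
  open import Data.List.Membership.Propositional.Properties using (∈-map⁺; ∈-concat⁺′; ∈-allFin)
  open import Relation.Nullary.Decidable using (does)
  open import Relation.Binary.PropositionalEquality
  open import Relation.Binary.Definitions using (DecidableEquality)
  open import Data.Nat.Tactic.RingSolver using (solve-∀)
  open import Defs using (allColourings)
  open FiniteSums

  Colouring : ℕ → Set
  Colouring = Vec (Fin 3)

  _≟C_ : ∀ {n} → DecidableEquality (Colouring n)
  _≟C_ = ≡-dec _≟F_

  -- [ x ≐ k ] is 1 if x = k and 0 otherwise (written as in the definition of countIn).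
  [_≐_] : Fin 3 → Fin 3 → ℕ
  [ x ≐ k ] = if does (x ≟F k) then 1 else 0

  partSize : ∀ {n} → Colouring n → Fin 3 → ℕ
  partSize []      k = 0
  partSize (x ∷ c) k = [ x ≐ k ] + partSize c k

  partSizes-sum : ∀ {n} (c : Colouring n) → partSize c zero + partSize c (suc zero) + partSize c (suc (suc zero)) ≡ n
  partSizes-sum [] = refl
  partSizes-sum (zero ∷ c)          = cong suc (partSizes-sum c)
  partSizes-sum (suc zero ∷ c)      = trans (cong (_+ partSize c (suc (suc zero))) (+-suc (partSize c zero) _)) (cong suc (partSizes-sum c))
  partSizes-sum (suc (suc zero) ∷ c) = trans (+-suc _ _) (cong suc (partSizes-sum c))

  ∑-colourings-suc : ∀ n (f : Colouring (suc n) → ℕ) →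
    ∑ (allColourings (suc n)) f ≡
    ∑ (allColourings n) (λ c → f (zero ∷ c)) + (∑ (allColourings n) (λ c → f (suc zero ∷ c)) +
      (∑ (allColourings n) (λ c → f (suc (suc zero) ∷ c)) + 0))
  ∑-colourings-suc n f = trans (∑-concatMap (λ x → map (x ∷_) (allColourings n)) (allFin 3) f)
    (cong₂ _+_ (∑-map (zero ∷_) (allColourings n) f) (cong₂ _+_ (∑-map (suc zero ∷_) (allColourings n) f)
      (cong₂ _+_ (∑-map (suc (suc zero) ∷_) (allColourings n) f) refl)))

  ∑-colourings-const : ∀ n k → ∑ (allColourings n) (λ _ → k) ≡ 3 ^ n * k
  ∑-colourings-const zero    k = refl
  ∑-colourings-const (suc n) k = trans (∑-colourings-suc n (λ _ → k))
    (trans (cong (λ z → z + (z + (z + 0))) (∑-colourings-const n k)) (thrice (3 ^ n) k))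
    where thrice : ∀ x k → x * k + (x * k + (x * k + 0)) ≡ 3 * x * k
          thrice = solve-∀

  ∈-allColourings : ∀ {n} (c : Colouring n) → c ∈ allColourings n
  ∈-allColourings [] = here refl
  ∈-allColourings {suc n} (x ∷ c) =
    ∈-concat⁺′ (∈-map⁺ (x ∷_) (∈-allColourings c)) (∈-map⁺ (λ y → map (y ∷_) (allColourings n)) (∈-allFin x))

  ∑-colourings-≟ : ∀ {n} (d : Colouring n) → ∑ (allColourings n) (λ c → 𝟙 (does (c ≟C d))) ≡ 1
  ∑-colourings-≟ [] = refl
  ∑-colourings-≟ {suc n} (zero ∷ d) = trans (∑-colourings-suc n _)
    (cong₂ _+_ (∑-colourings-≟ d) (cong₂ _+_ (∑-zero (allColourings n) (λ _ → refl)) (cong (_+ 0) (∑-zero (allColourings n) (λ _ → refl)))))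
  ∑-colourings-≟ {suc n} (suc zero ∷ d) = trans (∑-colourings-suc n _)
    (cong₂ _+_ (∑-zero (allColourings n) (λ _ → refl)) (cong₂ _+_ (∑-colourings-≟ d) (cong (_+ 0) (∑-zero (allColourings n) (λ _ → refl)))))
  ∑-colourings-≟ {suc n} (suc (suc zero) ∷ d) = trans (∑-colourings-suc n _)
    (cong₂ _+_ (∑-zero (allColourings n) (λ _ → refl)) (cong₂ _+_ (∑-zero (allColourings n) (λ _ → refl)) (cong (_+ 0) (∑-colourings-≟ d))))

  hasSizes : ∀ {n} → Colouring n → ℕ → ℕ → ℕ → Bool
  hasSizes c a b d = (partSize c zero ≡ᵇ a) ∧ ((partSize c (suc zero) ≡ᵇ b) ∧ (partSize c (suc (suc zero)) ≡ᵇ d))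

  #withSizes : ℕ → ℕ → ℕ → ℕ → ℕ
  #withSizes n a b d = ∑ (allColourings n) (λ c → 𝟙 (hasSizes c a b d))

  #withSizes-multinomial : ∀ n a b d → a + b + d ≡ n → #withSizes n a b d * (a ! * b ! * d !) ≡ n !
  #withSizes-multinomial zero zero zero zero eq = refl
  #withSizes-multinomial (suc n) a b d eq = begin
    #withSizes (suc n) a b d * P               ≡⟨ cong (_* P) (∑-colourings-suc n (λ c → 𝟙 (hasSizes c a b d))) ⟩
    (S₀ + (S₁ + (S₂ + 0))) * P                 ≡⟨ distrib S₀ S₁ S₂ P ⟩
    S₀ * P + S₁ * P + S₂ * P                   ≡⟨ cong₂ _+_ (cong₂ _+_ (part₀ a refl) (part₁ b refl)) (part₂ d refl) ⟩
    a * n ! + b * n ! + d * n !                ≡⟨ distrib' a b d (n !) ⟩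
    (a + b + d) * n !                          ≡⟨ cong (_* n !) eq ⟩
    suc n * n ! ∎
    where
    open ≡-Reasoning
    P S₀ S₁ S₂ : ℕ
    P  = a ! * b ! * d !
    S₀ = ∑ (allColourings n) (λ c → 𝟙 (hasSizes (zero ∷ c) a b d))
    S₁ = ∑ (allColourings n) (λ c → 𝟙 (hasSizes (suc zero ∷ c) a b d))
    S₂ = ∑ (allColourings n) (λ c → 𝟙 (hasSizes (suc (suc zero) ∷ c) a b d))
    distrib : ∀ x y z p → (x + (y + (z + 0))) * p ≡ x * p + y * p + z * p
    distrib = solve-∀
    distrib' : ∀ a b d f → a * f + b * f + d * f ≡ (a + b + d) * f
    distrib' = solve-∀
    -- Colourings with vertex 0 in part k are counted by the case n with part k
    -- one smaller (and there are none if part k is to be empty).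
    part₀ : ∀ a' → a' ≡ a → S₀ * P ≡ a * n !
    part₀ zero    refl = cong (_* P) (∑-zero (allColourings n) (λ _ → refl))
    part₀ (suc a') refl = trans (shift (#withSizes n a' b d) a' (a' !) (b !) (d !))
      (cong (suc a' *_) (#withSizes-multinomial n a' b d (suc-injective eq)))
      where shift : ∀ K a x y z → K * (suc a * x * y * z) ≡ suc a * (K * (x * y * z))
            shift = solve-∀
    part₁ : ∀ b' → b' ≡ b → S₁ * P ≡ b * n !
    part₁ zero    refl = cong (_* P) (∑-zero (allColourings n) (λ c → cong 𝟙 (∧-zeroʳ (partSize c zero ≡ᵇ a))))
    part₁ (suc b') refl = trans (shift (#withSizes n a b' d) b' (a !) (b' !) (d !))
      (cong (suc b' *_) (#withSizes-multinomial n a b' d (suc-injective (trans (+-suc-mid a b' d) eq))))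
      where shift : ∀ K b x y z → K * (x * (suc b * y) * z) ≡ suc b * (K * (x * y * z))
            shift = solve-∀
            +-suc-mid : ∀ a b d → suc (a + b + d) ≡ a + suc b + d
            +-suc-mid = solve-∀
    part₂ : ∀ d' → d' ≡ d → S₂ * P ≡ d * n !
    part₂ zero    refl = cong (_* P) (∑-zero (allColourings n)
      (λ c → cong 𝟙 (trans (cong ((partSize c zero ≡ᵇ a) ∧_) (∧-zeroʳ _)) (∧-zeroʳ _))))
    part₂ (suc d') refl = trans (shift (#withSizes n a b d') d' (a !) (b !) (d' !))
      (cong (suc d' *_) (#withSizes-multinomial n a b d' (suc-injective (trans (+-suc-end a b d') eq))))
      where shift : ∀ K d x y z → K * (x * y * (suc d * z)) ≡ suc d * (K * (x * y * z))
            shift = solve-∀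
            +-suc-end : ∀ a b d → suc (a + b + d) ≡ a + b + suc d
            +-suc-end = solve-∀

module Edges where

  open import Data.Bool using (Bool; true; false; _∧_; if_then_else_)
  open import Data.Bool.Properties using (∧-zeroʳ; T-∧)
  open import Data.Bool using () renaming (T to True)
  open import Data.Nat
  open import Data.Nat.Properties
  open import Data.Nat.Combinatorics using (_C_; nC1≡n; k>n⇒nCk≡0; nCk+nC[k+1]≡[n+1]C[k+1])
  open import Data.Fin using (Fin; zero; suc; punchIn; punchOut)
  open import Data.Fin.Properties using (punchIn-punchOut) renaming (_≟_ to _≟F_)
  open import Data.Fin.Subset using (Subset; ∣_∣)
  open import Data.Vec using (Vec; []; _∷_; lookup; insertAt; removeAt; replicate)
  open import Data.Vec.Properties using (lookup-replicate; insertAt-lookup; insertAt-punchIn; insertAt-removeAt; removeAt-punchOut)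
  open import Data.List using (List; map; allFin)
  import Data.List.Relation.Unary.All as All
  open import Data.List.Relation.Unary.All.Properties using (all⁺)
  open import Data.List.Membership.Propositional.Properties using (∈-allFin)
  open import Data.Bool.ListAction using (all)
  open import Relation.Nullary.Decidable using (does)
  open import Relation.Binary.PropositionalEquality
  open import Function using (_∘_; Equivalence)
  open import Data.Product using (proj₂)
  open import Data.Empty using (⊥-elim)
  open import Data.Nat.Tactic.RingSolver using (solve-∀)
  open import Defs using (allSubsets; threeSets; countIn; rainbow)
  open FiniteSums
  open Colourings

  -- The profile of a set e with respect to a colouring c is countIn c e : Fin 3 → ℕ,
  -- the number of vertices of e in each part.  f matches v says the profile f is v.
  -- By definition, rainbow c e is  countIn c e matches (1, 1, 1).
  _matches_ : (Fin 3 → ℕ) → Vec ℕ 3 → Bool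
  f matches v = all (λ k → f k ≡ᵇ lookup v k) (allFin 3)

  ∑-subsets-suc : ∀ n (f : Subset (suc n) → ℕ) →
    ∑ (allSubsets (suc n)) f ≡ ∑ (allSubsets n) (λ e → f (true ∷ e)) + ∑ (allSubsets n) (λ e → f (false ∷ e))
  ∑-subsets-suc n f = trans (∑-++ (map (true ∷_) (allSubsets n)) (map (false ∷_) (allSubsets n)) f)
    (cong₂ _+_ (∑-map (true ∷_) (allSubsets n) f) (∑-map (false ∷_) (allSubsets n) f))

  0C[1+k]≡0 : ∀ k → 0 C suc k ≡ 0
  0C[1+k]≡0 k = k>n⇒nCk≡0 {0} {suc k} (s≤s z≤n)

  #profile : ∀ {n} (c : Colouring n) a b d →
    ∑ (allSubsets n) (λ e → 𝟙 (countIn c e matches (a ∷ b ∷ d ∷ []))) ≡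
    (partSize c zero C a) * (partSize c (suc zero) C b) * (partSize c (suc (suc zero)) C d)
  #profile [] zero    zero    zero    = refl
  #profile [] zero    zero    (suc d) = sym (cong (1 * 1 *_) (0C[1+k]≡0 d))
  #profile [] zero    (suc b) d       = sym (cong (λ z → 1 * z * (0 C d)) (0C[1+k]≡0 b))
  #profile [] (suc a) b       d       = sym (cong (λ z → z * (0 C b) * (0 C d)) (0C[1+k]≡0 a))
  #profile {suc n} (zero ∷ c) zero b d = trans (∑-subsets-suc n _)
    (cong₂ _+_ (∑-zero (allSubsets n) (λ _ → refl)) (#profile c zero b d))
  #profile {suc n} (zero ∷ c) (suc a) b d = trans (∑-subsets-suc n _)
    (trans (cong₂ _+_ (#profile c a b d) (#profile c (suc a) b d))
    (trans (sym (pascal (p₀ C a) (p₀ C suc a) (p₁ C b) (p₂ C d)))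
           (cong (λ z → z * (p₁ C b) * (p₂ C d)) (nCk+nC[k+1]≡[n+1]C[k+1] p₀ a))))
    where p₀ p₁ p₂ : ℕ
          p₀ = partSize c zero
          p₁ = partSize c (suc zero)
          p₂ = partSize c (suc (suc zero))
          pascal : ∀ p q y z → (p + q) * y * z ≡ p * y * z + q * y * z
          pascal = solve-∀
  #profile {suc n} (suc zero ∷ c) a zero d = trans (∑-subsets-suc n _)
    (cong₂ _+_ (∑-zero (allSubsets n) (λ e → cong 𝟙 (∧-zeroʳ _))) (#profile c a zero d))
  #profile {suc n} (suc zero ∷ c) a (suc b) d = trans (∑-subsets-suc n _)
    (trans (cong₂ _+_ (#profile c a b d) (#profile c a (suc b) d))
    (trans (pascal (p₀ C a) (p₁ C b) (p₁ C suc b) (p₂ C d))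
           (cong (λ z → (p₀ C a) * z * (p₂ C d)) (nCk+nC[k+1]≡[n+1]C[k+1] p₁ b))))
    where p₀ p₁ p₂ : ℕ
          p₀ = partSize c zero
          p₁ = partSize c (suc zero)
          p₂ = partSize c (suc (suc zero))
          pascal : ∀ x p q z → x * p * z + x * q * z ≡ x * (p + q) * z
          pascal = solve-∀
  #profile {suc n} (suc (suc zero) ∷ c) a b zero = trans (∑-subsets-suc n _)
    (cong₂ _+_ (∑-zero (allSubsets n) (λ e → cong 𝟙 (trans (cong ((countIn c e zero ≡ᵇ a) ∧_) (∧-zeroʳ (countIn c e (suc zero) ≡ᵇ b))) (∧-zeroʳ _)))) (#profile c a b zero))
  #profile {suc n} (suc (suc zero) ∷ c) a b (suc d) = trans (∑-subsets-suc n _)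
    (trans (cong₂ _+_ (#profile c a b d) (#profile c a b (suc d)))
    (trans (pascal (p₀ C a) (p₁ C b) (p₂ C d) (p₂ C suc d))
           (cong ((p₀ C a) * (p₁ C b) *_) (nCk+nC[k+1]≡[n+1]C[k+1] p₂ d))))
    where p₀ p₁ p₂ : ℕ
          p₀ = partSize c zero
          p₁ = partSize c (suc zero)
          p₂ = partSize c (suc (suc zero))
          pascal : ∀ x y p q → x * y * p + x * y * q ≡ x * y * (p + q)
          pascal = solve-∀

  matches⇒≡ : ∀ f (v : Vec ℕ 3) → True (f matches v) → ∀ k → f k ≡ lookup v k
  matches⇒≡ f v h k = ≡ᵇ⇒≡ (f k) (lookup v k) (All.lookup (all⁺ (λ k → f k ≡ᵇ lookup v k) (allFin 3) h) (∈-allFin k))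

  size≡∑parts : ∀ {n} (c : Colouring n) (e : Subset n) →
    ∣ e ∣ ≡ countIn c e zero + (countIn c e (suc zero) + countIn c e (suc (suc zero)))
  size≡∑parts []                   []          = refl
  size≡∑parts (x ∷ c)              (false ∷ e) = size≡∑parts c e
  size≡∑parts (zero ∷ c)           (true ∷ e)  = cong suc (size≡∑parts c e)
  size≡∑parts (suc zero ∷ c)       (true ∷ e)  = trans (cong suc (size≡∑parts c e)) (sym (+-suc _ _))
  size≡∑parts (suc (suc zero) ∷ c) (true ∷ e)  =
    trans (cong suc (size≡∑parts c e)) (sym (trans (cong (countIn c e zero +_) (+-suc _ _)) (+-suc _ _)))

  rainbow⇒once : ∀ {n} (c : Colouring n) (e : Subset n) → True (rainbow c e) → ∀ k → countIn c e k ≡ 1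
  rainbow⇒once c e h k = trans (matches⇒≡ (countIn c e) (replicate 3 1) h k) (lookup-replicate k 1)

  rainbow⇒size3 : ∀ {n} (c : Colouring n) (e : Subset n) → True (rainbow c e) → ∣ e ∣ ≡ 3
  rainbow⇒size3 c e h = trans (size≡∑parts c e)
    (cong₂ _+_ (once zero) (cong₂ _+_ (once (suc zero)) (once (suc (suc zero)))))
    where once : ∀ k → countIn c e k ≡ 1
          once = rainbow⇒once c e h

  ∑-threeSets : ∀ {n} (f : Subset n → Bool) → (∀ e → True (f e) → ∣ e ∣ ≡ 3) →
    ∑ (threeSets n) (𝟙 ∘ f) ≡ ∑ (allSubsets n) (𝟙 ∘ f)
  ∑-threeSets {n} f size3 = trans (∑-filter (λ e → ∣ e ∣ ≟ 3) (allSubsets n) (𝟙 ∘ f))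
    (∑-cong (allSubsets n) dropSizeTest)
    where
    dropSizeTest : ∀ e → 𝟙 (does (∣ e ∣ ≟ 3)) * 𝟙 (f e) ≡ 𝟙 (f e)
    dropSizeTest e with f e in eq
    ... | false = *-zeroʳ (𝟙 (does (∣ e ∣ ≟ 3)))
    ... | true rewrite size3 e (subst True (sym eq) _) = refl

  #rainbow : ∀ {n} (c : Colouring n) →
    ∑ (threeSets n) (𝟙 ∘ rainbow c) ≡ partSize c zero * partSize c (suc zero) * partSize c (suc (suc zero))
  #rainbow c = trans (∑-threeSets (rainbow c) (rainbow⇒size3 c)) (trans (#profile c 1 1 1)
    (cong₂ _*_ (cong₂ _*_ (nC1≡n (partSize c zero)) (nC1≡n (partSize c (suc zero)))) (nC1≡n (partSize c (suc (suc zero))))))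

  matches-cong : ∀ {f g : Fin 3 → ℕ} (v : Vec ℕ 3) → (∀ k → f k ≡ g k) → f matches v ≡ g matches v
  matches-cong v eq = cong₂ _∧_ (cong (_≡ᵇ lookup v zero) (eq zero))
    (cong₂ _∧_ (cong (_≡ᵇ lookup v (suc zero)) (eq (suc zero)))
      (cong (_∧ true) (cong (_≡ᵇ lookup v (suc (suc zero))) (eq (suc (suc zero))))))

  ∑-subsets-insertAt : ∀ {n} (p : Fin (suc n)) (f : Subset (suc n) → ℕ) →
    ∑ (allSubsets (suc n)) f ≡
    ∑ (allSubsets n) (λ e → f (insertAt e p true)) + ∑ (allSubsets n) (λ e → f (insertAt e p false))
  ∑-subsets-insertAt {n} zero f = ∑-subsets-suc n f
  ∑-subsets-insertAt {suc n} (suc p) f = begin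
    ∑ S₊ f                                                        ≡⟨ ∑-subsets-suc (suc n) f ⟩
    ∑ S (λ e → f (true ∷ e)) + ∑ S (λ e → f (false ∷ e))
      ≡⟨ cong₂ _+_ (∑-subsets-insertAt p (λ e → f (true ∷ e))) (∑-subsets-insertAt p (λ e → f (false ∷ e))) ⟩
    (in₁ + out₁) + (in₀ + out₀)                                     ≡⟨ interchange in₁ out₁ in₀ out₀ ⟩
    (in₁ + in₀) + (out₁ + out₀)
      ≡⟨ sym (cong₂ _+_ (∑-subsets-suc n (λ e → f (insertAt e (suc p) true))) (∑-subsets-suc n (λ e → f (insertAt e (suc p) false)))) ⟩
    ∑ (allSubsets (suc n)) (λ e → f (insertAt e (suc p) true)) + ∑ (allSubsets (suc n)) (λ e → f (insertAt e (suc p) false)) ∎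
    where
    open ≡-Reasoning
    S₊ : List (Subset (suc (suc n)))
    S₊ = allSubsets (suc (suc n))
    S : List (Subset (suc n))
    S  = allSubsets (suc n)
    in₁ : ℕ
    in₁  = ∑ (allSubsets n) (λ e → f (true ∷ insertAt e p true))
    out₁ : ℕ
    out₁ = ∑ (allSubsets n) (λ e → f (true ∷ insertAt e p false))
    in₀ : ℕ
    in₀  = ∑ (allSubsets n) (λ e → f (false ∷ insertAt e p true))
    out₀ : ℕ
    out₀ = ∑ (allSubsets n) (λ e → f (false ∷ insertAt e p false))
    interchange : ∀ a b c d → (a + b) + (c + d) ≡ (a + c) + (b + d)
    interchange = solve-∀

  ∑-subsets-∋ : ∀ {n} (p : Fin (suc n)) (g : Subset (suc n) → Bool) →
    ∑ (allSubsets (suc n)) (λ e → 𝟙 (lookup e p ∧ g e)) ≡ ∑ (allSubsets n) (λ e → 𝟙 (g (insertAt e p true)))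
  ∑-subsets-∋ {n} p g = trans (∑-subsets-insertAt p _)
    (trans (cong₂ _+_ (∑-cong (allSubsets n) withP) (∑-zero (allSubsets n) withoutP)) (+-identityʳ _))
    where
    withP : ∀ e → 𝟙 (lookup (insertAt e p true) p ∧ g (insertAt e p true)) ≡ 𝟙 (g (insertAt e p true))
    withP e rewrite insertAt-lookup e p true = refl
    withoutP : ∀ e → 𝟙 (lookup (insertAt e p false) p ∧ g (insertAt e p false)) ≡ 0
    withoutP e rewrite insertAt-lookup e p false = refl

  countIn-insertAt : ∀ {n} (c : Colouring n) (e : Subset n) (p : Fin (suc n)) x k →
    countIn (insertAt c p x) (insertAt e p true) k ≡ [ x ≐ k ] + countIn c e k
  countIn-insertAt c e zero x k = refl
  countIn-insertAt (y ∷ c) (b ∷ e) (suc p) x k =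
    trans (cong ((if b ∧ does (y ≟F k) then 1 else 0) +_) (countIn-insertAt c e p x k)) (x+[y+z]≡y+[x+z] (if b ∧ does (y ≟F k) then 1 else 0) [ x ≐ k ] (countIn c e k))
    where x+[y+z]≡y+[x+z] : ∀ a b c → a + (b + c) ≡ b + (a + c)
          x+[y+z]≡y+[x+z] = solve-∀

  partSize-insertAt : ∀ {n} (c : Colouring n) (p : Fin (suc n)) x k →
    partSize (insertAt c p x) k ≡ [ x ≐ k ] + partSize c k
  partSize-insertAt c zero x k = refl
  partSize-insertAt (y ∷ c) (suc p) x k =
    trans (cong ([ y ≐ k ] +_) (partSize-insertAt c p x k)) (x+[y+z]≡y+[x+z] [ y ≐ k ] [ x ≐ k ] _)
    where x+[y+z]≡y+[x+z] : ∀ a b c → a + (b + c) ≡ b + (a + c)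
          x+[y+z]≡y+[x+z] = solve-∀

  third : Fin 3 → Fin 3 → Fin 3
  third zero             (suc zero)       = suc (suc zero)
  third (suc zero)       zero             = suc (suc zero)
  third zero             (suc (suc zero)) = suc zero
  third (suc (suc zero)) zero             = suc zero
  third _                _                = zero

  third-avoids : ∀ {x y} → x ≢ y → ∀ m → [ x ≐ third x y ] + ([ y ≐ third x y ] + m) ≡ m
  third-avoids {zero}           {zero}           x≢y = ⊥-elim (x≢y refl)
  third-avoids {zero}           {suc zero}       _ m = refl
  third-avoids {zero}           {suc (suc zero)} _ m = refl
  third-avoids {suc zero}       {zero}           _ m = refl
  third-avoids {suc zero}       {suc zero}       x≢y = ⊥-elim (x≢y refl)
  third-avoids {suc zero}       {suc (suc zero)} _ m = refl
  third-avoids {suc (suc zero)} {zero}           _ m = refl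
  third-avoids {suc (suc zero)} {suc zero}       _ m = refl
  third-avoids {suc (suc zero)} {suc (suc zero)} x≢y = ⊥-elim (x≢y refl)

  -- The profile of a single vertex of colour z.
  unit : Fin 3 → Vec ℕ 3
  unit z = [ z ≐ zero ] ∷ [ z ≐ suc zero ] ∷ [ z ≐ suc (suc zero) ] ∷ []

  rainbow-through-xy : ∀ (f : Fin 3 → ℕ) {x y} → x ≢ y →
    (λ k → [ x ≐ k ] + ([ y ≐ k ] + f k)) matches (1 ∷ 1 ∷ 1 ∷ []) ≡ f matches unit (third x y)
  rainbow-through-xy f {zero}           {zero}           x≢y = ⊥-elim (x≢y refl)
  rainbow-through-xy f {zero}           {suc zero}       _   = refl
  rainbow-through-xy f {zero}           {suc (suc zero)} _   = refl
  rainbow-through-xy f {suc zero}       {zero}           _   = refl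
  rainbow-through-xy f {suc zero}       {suc zero}       x≢y = ⊥-elim (x≢y refl)
  rainbow-through-xy f {suc zero}       {suc (suc zero)} _   = refl
  rainbow-through-xy f {suc (suc zero)} {zero}           _   = refl
  rainbow-through-xy f {suc (suc zero)} {suc zero}       _   = refl
  rainbow-through-xy f {suc (suc zero)} {suc (suc zero)} x≢y = ⊥-elim (x≢y refl)

  #unit : ∀ {n} (c : Colouring n) z → ∑ (allSubsets n) (λ e → 𝟙 (countIn c e matches unit z)) ≡ partSize c z
  #unit c zero = trans (#profile c 1 0 0) (trans (*-identityʳ _) (trans (*-identityʳ _) (nC1≡n _)))
  #unit c (suc zero) = trans (#profile c 0 1 0) (trans (*-identityʳ _) (trans (+-identityʳ _) (nC1≡n _)))
  #unit c (suc (suc zero)) = trans (#profile c 0 0 1) (trans (+-identityʳ _) (nC1≡n _))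

  through : ∀ {n} → Colouring n → Fin n → Fin n → ℕ
  through {n} c u v = ∑ (allSubsets n) (λ e → 𝟙 (lookup e u ∧ (lookup e v ∧ rainbow c e)))

  through-inserted : ∀ {n} (c : Colouring n) p q {x y} → x ≢ y →
    through (insertAt (insertAt c q y) p x) p (punchIn p q) ≡ partSize c (third x y)
  through-inserted {n} c p q {x} {y} x≢y = begin
    through (insertAt c₁ p x) p (punchIn p q)
      ≡⟨ ∑-subsets-∋ p _ ⟩
    ∑ (allSubsets (suc n)) (λ e → 𝟙 (lookup (insertAt e p true) (punchIn p q) ∧ rainbow (insertAt c₁ p x) (insertAt e p true)))
      ≡⟨ ∑-cong (allSubsets (suc n)) (λ e → cong 𝟙 (cong₂ _∧_ (insertAt-punchIn e p true q)
           (matches-cong (1 ∷ 1 ∷ 1 ∷ []) (countIn-insertAt c₁ e p x)))) ⟩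
    ∑ (allSubsets (suc n)) (λ e → 𝟙 (lookup e q ∧ ((λ k → [ x ≐ k ] + countIn c₁ e k) matches (1 ∷ 1 ∷ 1 ∷ []))))
      ≡⟨ ∑-subsets-∋ q _ ⟩
    ∑ (allSubsets n) (λ e → 𝟙 ((λ k → [ x ≐ k ] + countIn c₁ (insertAt e q true) k) matches (1 ∷ 1 ∷ 1 ∷ [])))
      ≡⟨ ∑-cong (allSubsets n) (λ e → cong 𝟙 (trans
           (matches-cong (1 ∷ 1 ∷ 1 ∷ []) (λ k → cong ([ x ≐ k ] +_) (countIn-insertAt c e q y k)))
           (rainbow-through-xy (countIn c e) x≢y))) ⟩
    ∑ (allSubsets n) (λ e → 𝟙 (countIn c e matches unit (third x y)))
      ≡⟨ #unit c (third x y) ⟩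
    partSize c (third x y) ∎
    where
    open ≡-Reasoning
    c₁ : Colouring (suc n)
    c₁ = insertAt c q y

  #rainbow-through : ∀ {n} (c : Colouring n) u v → lookup c u ≢ lookup c v →
    ∑ (threeSets n) (λ e → 𝟙 (lookup e u ∧ (lookup e v ∧ rainbow c e))) ≡ partSize c (third (lookup c u) (lookup c v))
  #rainbow-through {n} c u v cu≢cv = trans (∑-threeSets _ edgeIsRainbow) (count n c u v cu≢cv)
    where
    edgeIsRainbow : ∀ e → True (lookup e u ∧ (lookup e v ∧ rainbow c e)) → ∣ e ∣ ≡ 3
    edgeIsRainbow e h = rainbow⇒size3 c e
      (proj₂ (Equivalence.to (T-∧ {lookup e v}) (proj₂ (Equivalence.to (T-∧ {lookup e u}) h))))
    count : ∀ n (c : Colouring n) u v → lookup c u ≢ lookup c v → through c u v ≡ partSize c (third (lookup c u) (lookup c v))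
    count (suc zero) c zero zero cu≢cv = ⊥-elim (cu≢cv refl)
    count (suc (suc m)) c u v cu≢cv = begin
      through c u v                            ≡⟨ cong₂ (λ d w → through d u w) (sym c≡) (sym v≡) ⟩
      through (insertAt c₂′ u x) u (punchIn u v₁) ≡⟨ through-inserted c₂ u v₁ x≢y ⟩
      partSize c₂ (third x y)                  ≡⟨ sym (third-avoids x≢y (partSize c₂ (third x y))) ⟩
      [ x ≐ t ] + ([ y ≐ t ] + partSize c₂ t)  ≡⟨ cong ([ x ≐ t ] +_) (sym (partSize-insertAt c₂ v₁ y t)) ⟩
      [ x ≐ t ] + partSize c₂′ t               ≡⟨ sym (partSize-insertAt c₂′ u x t) ⟩
      partSize (insertAt c₂′ u x) t            ≡⟨ cong₂ partSize c≡ (cong (third x) y≡) ⟩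
      partSize c (third x (lookup c v)) ∎
      where
      open ≡-Reasoning
      x : Fin 3
      x = lookup c u
      u≢v : u ≢ v
      u≢v u≡v = cu≢cv (cong (lookup c) u≡v)
      v₁ : Fin (suc m)
      v₁ = punchOut u≢v
      c₁ : Colouring (suc m)
      c₁ = removeAt c u
      y : Fin 3
      y  = lookup c₁ v₁
      c₂ : Colouring m
      c₂ = removeAt c₁ v₁
      c₂′ : Colouring (suc m)
      c₂′ = insertAt c₂ v₁ y
      t : Fin 3
      t  = third x y
      y≡ : y ≡ lookup c v
      y≡ = removeAt-punchOut c u≢v
      x≢y : x ≢ y
      x≢y x≡y = cu≢cv (trans x≡y y≡)
      c≡ : insertAt c₂′ u x ≡ c
      c≡ = trans (cong (λ z → insertAt z u x) (insertAt-removeAt c₁ v₁)) (insertAt-removeAt c u)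
      v≡ : punchIn u v₁ ≡ v
      v≡ = punchIn-punchOut u≢v

module Thirds where

  open import Data.Nat
  open import Data.Nat.Properties
  open import Data.Nat.DivMod
  open import Data.Sum using (_⊎_; inj₁; inj₂)
  open import Relation.Binary.PropositionalEquality
  open import Data.Nat.Tactic.RingSolver using (solve-∀)
  open import Defs using (s)

  open ≤-Reasoning

  data Mod3 : ℕ → Set where
    ≡0 : ∀ m → Mod3 (3 * m)
    ≡1 : ∀ m → Mod3 (3 * m + 1)
    ≡2 : ∀ m → Mod3 (3 * m + 2)

  mod3 : ∀ n → Mod3 n
  mod3 zero = ≡0 0
  mod3 (suc n) with mod3 n
  ... | ≡0 m = subst Mod3 (+-comm (3 * m) 1) (≡1 m)
  ... | ≡1 m = subst Mod3 (suc≡ m) (≡2 m)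
    where suc≡ : ∀ m → 3 * m + 2 ≡ suc (3 * m + 1)
          suc≡ = solve-∀
  ... | ≡2 m = subst Mod3 (suc≡ m) (≡0 (suc m))
    where suc≡ : ∀ m → 3 * suc m ≡ suc (3 * m + 2)
          suc≡ = solve-∀

  [3+n]/3≡1+n/3 : ∀ n → (3 + n) / 3 ≡ suc (n / 3)
  [3+n]/3≡1+n/3 n = m/n≡1+[m∸n]/n {3 + n} {3} (s≤s (s≤s (s≤s z≤n)))

  [3m+t]/3≡m+t/3 : ∀ m t → (3 * m + t) / 3 ≡ m + t / 3
  [3m+t]/3≡m+t/3 zero    t = refl
  [3m+t]/3≡m+t/3 (suc m) t = trans (cong (_/ 3) (shift m t)) (trans ([3+n]/3≡1+n/3 (3 * m + t)) (cong suc ([3m+t]/3≡m+t/3 m t)))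
    where shift : ∀ m t → 3 * suc m + t ≡ 3 + (3 * m + t)
          shift = solve-∀

  n≤3[n/3]+2 : ∀ n → n ≤ 3 * (n / 3) + 2
  n≤3[n/3]+2 n = begin
    n                  ≡⟨ m≡m%n+[m/n]*n n 3 ⟩
    n % 3 + n / 3 * 3  ≤⟨ +-monoˡ-≤ (n / 3 * 3) (s≤s⁻¹ (m%n<n n 3)) ⟩
    2 + n / 3 * 3      ≡⟨ +-comm 2 (n / 3 * 3) ⟩
    n / 3 * 3 + 2      ≡⟨ cong (_+ 2) (*-comm (n / 3) 3) ⟩
    3 * (n / 3) + 2    ∎

  3[n/3]≤n : ∀ n → 3 * (n / 3) ≤ n
  3[n/3]≤n n = subst (_≤ n) (*-comm (n / 3) 3) (m/n*n≤m n 3)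

  n≤3[[n+2]/3] : ∀ n → n ≤ 3 * ((n + 2) / 3)
  n≤3[[n+2]/3] n = +-cancelʳ-≤ 2 n (3 * ((n + 2) / 3)) (n≤3[n/3]+2 (n + 2))

  floors-sum : ∀ n → (n + 2) / 3 + (n + 1) / 3 + n / 3 ≡ n
  floors-sum n = go (mod3 n)
    where
    go : ∀ {n} → Mod3 n → (n + 2) / 3 + (n + 1) / 3 + n / 3 ≡ n
    go (≡0 m) = trans (cong₂ _+_ (cong₂ _+_ ([3m+t]/3≡m+t/3 m 2) ([3m+t]/3≡m+t/3 m 1)) (div m))
      (sum m)
      where div : ∀ m → 3 * m / 3 ≡ m + 0 / 3
            div m = trans (cong (_/ 3) (sym (+-identityʳ (3 * m)))) ([3m+t]/3≡m+t/3 m 0)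
            sum : ∀ m → m + 0 + (m + 0) + (m + 0) ≡ 3 * m
            sum = solve-∀
    go (≡1 m) = trans (cong₂ _+_ (cong₂ _+_ (trans (cong (_/ 3) (+-assoc (3 * m) 1 2)) ([3m+t]/3≡m+t/3 m 3))
                                             (trans (cong (_/ 3) (+-assoc (3 * m) 1 1)) ([3m+t]/3≡m+t/3 m 2)))
                                 ([3m+t]/3≡m+t/3 m 1))
      (sum m)
      where sum : ∀ m → m + 1 + (m + 0) + (m + 0) ≡ 3 * m + 1
            sum = solve-∀
    go (≡2 m) = trans (cong₂ _+_ (cong₂ _+_ (trans (cong (_/ 3) (+-assoc (3 * m) 2 2)) ([3m+t]/3≡m+t/3 m 4))
                                             (trans (cong (_/ 3) (+-assoc (3 * m) 2 1)) ([3m+t]/3≡m+t/3 m 3)))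
                                 ([3m+t]/3≡m+t/3 m 2))
      (sum m)
      where sum : ∀ m → m + 1 + (m + 1) + (m + 0) ≡ 3 * m + 2
            sum = solve-∀

  Δs : ℕ → ℕ
  Δs n = (n + 1) / 3 * ((n + 2) / 3)

  s-suc : ∀ n → s (suc n) ≡ s n + Δs n
  s-suc n = trans (cong₂ _*_ (cong₂ _*_ (cong (_/ 3) (+-comm 1 n)) (cong (_/ 3) (sym (+-suc n 1))))
                            (trans (cong (λ m → suc m / 3) (+-comm n 2)) ([3+n]/3≡1+n/3 n)))
                  (rearrange ((n + 1) / 3) ((n + 2) / 3) (n / 3))
    where rearrange : ∀ x y z → x * y * suc z ≡ z * x * y + x * y
          rearrange = solve-∀

  -- 4bd ≤ (b + d)², first for b ≤ d, writing d = b + t: (b + d)² = 4bd + t².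
  4bd≤[b+d]²-ordered : ∀ {b d} → b ≤ d → 4 * (b * d) ≤ (b + d) * (b + d)
  4bd≤[b+d]²-ordered {b} {d} b≤d = subst (λ z → 4 * (b * z) ≤ (b + z) * (b + z)) (m+[n∸m]≡n b≤d)
    (subst (4 * (b * (b + t)) ≤_) (square b t) (m≤m+n _ (t * t)))
    where t : ℕ
          t = d ∸ b
          square : ∀ x t → 4 * (x * (x + t)) + t * t ≡ (x + (x + t)) * (x + (x + t))
          square = solve-∀

  4bd≤[b+d]² : ∀ b d → 4 * (b * d) ≤ (b + d) * (b + d)
  4bd≤[b+d]² b d with ≤-total b d
  ... | inj₁ b≤d = 4bd≤[b+d]²-ordered b≤d
  ... | inj₂ d≤b = subst₂ _≤_ (cong (4 *_) (*-comm d b)) (cong (λ z → z * z) (+-comm d b)) (4bd≤[b+d]²-ordered d≤b)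

  [P+Q]²≤4PQ+1 : ∀ {P Q} → P ≤ Q → Q ≤ suc P → (P + Q) * (P + Q) ≤ 4 * (P * Q) + 1
  [P+Q]²≤4PQ+1 {P} P≤Q Q≤1+P with m≤n⇒m<n∨m≡n Q≤1+P
  ... | inj₂ refl = ≤-reflexive (oddSquare P)
    where oddSquare : ∀ P → (P + suc P) * (P + suc P) ≡ 4 * (P * suc P) + 1
          oddSquare = solve-∀
  ... | inj₁ Q<1+P rewrite ≤-antisym (s≤s⁻¹ Q<1+P) P≤Q = ≤-trans (≤-reflexive (evenSquare P)) (m≤m+n _ 1)
    where evenSquare : ∀ P → (P + P) * (P + P) ≡ 4 * (P * P)
          evenSquare = solve-∀

  balanced-product : ∀ {b d P Q} → b + d ≤ P + Q → P ≤ Q → Q ≤ suc P → b * d ≤ P * Q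
  balanced-product {b} {d} {P} {Q} b+d≤ P≤Q Q≤1+P = s≤s⁻¹ (*-cancelˡ-< 4 (b * d) (suc (P * Q)) (begin-strict
    4 * (b * d)           ≤⟨ 4bd≤[b+d]² b d ⟩
    (b + d) * (b + d)     ≤⟨ *-mono-≤ b+d≤ b+d≤ ⟩
    (P + Q) * (P + Q)     ≤⟨ [P+Q]²≤4PQ+1 P≤Q Q≤1+P ⟩
    4 * (P * Q) + 1       <⟨ +-monoʳ-< (4 * (P * Q)) (s≤s (s≤s z≤n)) ⟩
    4 * (P * Q) + 4       ≡⟨ *-suc-4 (P * Q) ⟩
    4 * suc (P * Q)       ∎))
    where *-suc-4 : ∀ x → 4 * x + 4 ≡ 4 * suc x
          *-suc-4 = solve-∀

  smaller-parts : ∀ {n a b d} → b ≤ a → d ≤ a → a + b + d ≡ suc n → b + d ≤ (n + 1) / 3 + (n + 2) / 3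
  smaller-parts {n} {a} {b} {d} b≤a d≤a sum≡ = +-cancelʳ-≤ D (b + d) (P + Q) (s≤s⁻¹ (*-cancelˡ-< 3 _ _ (begin-strict
    3 * (b + d + D)              ≡⟨ *-distribˡ-+ 3 (b + d) D ⟩
    3 * (b + d) + 3 * D          ≤⟨ +-mono-≤ two-thirds (3[n/3]≤n n) ⟩
    2 * suc n + n                <⟨ ≤-reflexive (one-short n) ⟩
    3 * suc n                    ≡⟨ cong (λ m → 3 * suc m) (sym parts) ⟩
    3 * suc (P + Q + D)          ∎)))
    where
    P : ℕ
    P = (n + 1) / 3
    Q : ℕ
    Q = (n + 2) / 3
    D : ℕ
    D = n / 3
    one-short : ∀ n → suc (2 * suc n + n) ≡ 3 * suc n
    one-short = solve-∀
    two-thirds : 3 * (b + d) ≤ 2 * suc n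
    two-thirds = subst (3 * (b + d) ≤_) (cong (2 *_) sum≡) (begin
      3 * (b + d)              ≡⟨ split b d ⟩
      (b + d) + 2 * (b + d)    ≤⟨ +-monoˡ-≤ (2 * (b + d)) (+-mono-≤ b≤a d≤a) ⟩
      (a + a) + 2 * (b + d)    ≡⟨ merge a b d ⟩
      2 * (a + b + d)          ∎)
      where split : ∀ b d → 3 * (b + d) ≡ (b + d) + 2 * (b + d)
            split = solve-∀
            merge : ∀ a b d → (a + a) + 2 * (b + d) ≡ 2 * (a + b + d)
            merge = solve-∀
    parts : P + Q + D ≡ n
    parts = suc-injective (trans (reorder P Q D) (trans (cong₂ _+_ (cong₂ _+_ ⌊[n+3]/3⌋ ⌊[n+2]/3⌋) ⌊[n+1]/3⌋) (floors-sum (suc n))))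
      where reorder : ∀ P Q D → suc (P + Q + D) ≡ suc D + Q + P
            reorder = solve-∀
            ⌊[n+3]/3⌋ : suc D ≡ (suc n + 2) / 3
            ⌊[n+3]/3⌋ = sym (trans (cong (λ m → suc m / 3) (+-comm n 2)) ([3+n]/3≡1+n/3 n))
            ⌊[n+2]/3⌋ : Q ≡ (suc n + 1) / 3
            ⌊[n+2]/3⌋ = cong (_/ 3) (+-suc n 1)
            ⌊[n+1]/3⌋ : P ≡ suc n / 3
            ⌊[n+1]/3⌋ = cong (_/ 3) (+-comm n 1)

  [n+1]/3≤[n+2]/3 : ∀ n → (n + 1) / 3 ≤ (n + 2) / 3
  [n+1]/3≤[n+2]/3 n = /-monoˡ-≤ 3 (+-monoʳ-≤ n (s≤s z≤n))

  [n+2]/3≤1+[n+1]/3 : ∀ n → (n + 2) / 3 ≤ suc ((n + 1) / 3)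
  [n+2]/3≤1+[n+1]/3 n = ≤-trans (/-monoˡ-≤ 3 (m≤n+m (n + 2) 2)) (≤-reflexive (trans (cong (_/ 3) (shift n)) ([3+n]/3≡1+n/3 (n + 1))))
    where shift : ∀ n → 2 + (n + 2) ≡ 3 + (n + 1)
          shift = solve-∀

  -- Induction step for the bound below: remove one vertex from the largest part a;
  -- the product drops by b·d, which is at most s(n+1) − s(n).
  product≤s-step : ∀ n a b d → b ≤ a → d ≤ a → a + b + d ≡ suc n →
    (∀ a b d → a + b + d ≡ n → a * b * d ≤ s n) → a * b * d ≤ s (suc n)
  product≤s-step n (suc a) b d b≤a d≤a sum≡ bound = begin
    suc a * b * d          ≡⟨ peel a b d ⟩
    a * b * d + b * d      ≤⟨ +-mono-≤ (bound a b d (suc-injective sum≡)) smaller ⟩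
    s n + Δs n             ≡⟨ sym (s-suc n) ⟩
    s (suc n)              ∎
    where
    peel : ∀ a b d → suc a * b * d ≡ a * b * d + b * d
    peel = solve-∀
    smaller : b * d ≤ Δs n
    smaller = balanced-product {b} {d} (smaller-parts b≤a d≤a sum≡) ([n+1]/3≤[n+2]/3 n) ([n+2]/3≤1+[n+1]/3 n)
  product≤s-step n zero zero zero z≤n z≤n ()

  product≤s : ∀ n a b d → a + b + d ≡ n → a * b * d ≤ s n
  product≤s zero zero zero zero refl = z≤n
  product≤s (suc n) a b d sum≡ = byLargest (≤-total b a) (≤-total d a) (≤-total d b)
    where
    -- The bound is symmetric, so we may remove the vertex from whichever part is largest.
    largest-last : d * a * b ≤ s (suc n) → a * b * d ≤ s (suc n)
    largest-last = subst (_≤ s (suc n)) (rot a b d)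
      where rot : ∀ a b d → d * a * b ≡ a * b * d
            rot = solve-∀
    largest-middle : b * a * d ≤ s (suc n) → a * b * d ≤ s (suc n)
    largest-middle = subst (_≤ s (suc n)) (cong (_* d) (*-comm b a))
    sum-rot : d + a + b ≡ suc n
    sum-rot = trans (rot a b d) sum≡
      where rot : ∀ a b d → d + a + b ≡ a + b + d
            rot = solve-∀
    sum-swap : b + a + d ≡ suc n
    sum-swap = trans (cong (_+ d) (+-comm b a)) sum≡
    byLargest : b ≤ a ⊎ a ≤ b → d ≤ a ⊎ a ≤ d → d ≤ b ⊎ b ≤ d → a * b * d ≤ s (suc n)
    byLargest (inj₁ b≤a) (inj₁ d≤a) _ = product≤s-step n a b d b≤a d≤a sum≡ (product≤s n)
    byLargest (inj₁ b≤a) (inj₂ a≤d) _ = largest-last (product≤s-step n d a b a≤d (≤-trans b≤a a≤d) sum-rot (product≤s n))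
    byLargest (inj₂ a≤b) _ (inj₁ d≤b) = largest-middle (product≤s-step n b a d a≤b d≤b sum-swap (product≤s n))
    byLargest (inj₂ a≤b) _ (inj₂ b≤d) = largest-last (product≤s-step n d a b (≤-trans a≤b b≤d) b≤d sum-rot (product≤s n))

  -- 9 (s(k+2) − s(k+1)) ≥ k (k + 1), as 3⌊(k+2)/3⌋ ≥ k and 3⌊(k+3)/3⌋ ≥ k + 1.
  k[k+1]≤9Δs[k+1] : ∀ k → k * suc k ≤ 9 * Δs (suc k)
  k[k+1]≤9Δs[k+1] k = begin
    k * suc k                                  ≤⟨ *-mono-≤ (n≤3[[n+2]/3] k) (n≤3[[n+2]/3] (suc k)) ⟩
    3 * ((k + 2) / 3) * (3 * ((suc k + 2) / 3)) ≡⟨ cong (λ m → 3 * (m / 3) * (3 * ((suc k + 2) / 3))) (+-suc k 1) ⟩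
    3 * ((suc k + 1) / 3) * (3 * ((suc k + 2) / 3)) ≡⟨ nine ((suc k + 1) / 3) ((suc k + 2) / 3) ⟩
    9 * Δs (suc k)                             ∎
    where nine : ∀ x y → 3 * x * (3 * y) ≡ 9 * (x * y)
          nine = solve-∀

  -- s(n) − s(n − 2) ≥ (2n² − 8n)/9 for n = k + 3, from two increments of s.
  s-gap′ : ∀ k → 9 * s (suc k) + 2 * ((3 + k) * (3 + k)) ≤ 9 * s (3 + k) + 8 * (3 + k)
  s-gap′ k = begin
    9 * s (suc k) + 2 * ((3 + k) * (3 + k))
      ≤⟨ m≤m+n _ 8 ⟩
    9 * s (suc k) + 2 * ((3 + k) * (3 + k)) + 8
      ≡⟨ expand (s (suc k)) k ⟩
    9 * s (suc k) + (k * suc k + suc k * suc (suc k)) + 8 * (3 + k)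
      ≤⟨ +-monoˡ-≤ (8 * (3 + k)) (+-monoʳ-≤ (9 * s (suc k)) (+-mono-≤ (k[k+1]≤9Δs[k+1] k) (k[k+1]≤9Δs[k+1] (suc k)))) ⟩
    9 * s (suc k) + (9 * Δs (suc k) + 9 * Δs (suc (suc k))) + 8 * (3 + k)
      ≡⟨ cong (_+ 8 * (3 + k)) (collect (s (suc k)) (Δs (suc k)) (Δs (suc (suc k)))) ⟩
    9 * (s (suc k) + Δs (suc k) + Δs (suc (suc k))) + 8 * (3 + k)
      ≡⟨ cong (λ m → 9 * m + 8 * (3 + k)) (sym (trans (s-suc (suc (suc k))) (cong (_+ Δs (suc (suc k))) (s-suc (suc k))))) ⟩
    9 * s (3 + k) + 8 * (3 + k) ∎
    where
    expand : ∀ S k → 9 * S + 2 * ((3 + k) * (3 + k)) + 8 ≡ 9 * S + (k * suc k + suc k * suc (suc k)) + 8 * (3 + k)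
    expand = solve-∀
    collect : ∀ S x y → 9 * S + (9 * x + 9 * y) ≡ 9 * (S + x + y)
    collect = solve-∀

  s-gap : ∀ n → 3 ≤ n → 9 * s (n ∸ 2) + 2 * (n * n) ≤ 9 * s n + 8 * n
  s-gap (suc (suc (suc k))) (s≤s (s≤s (s≤s z≤n))) = s-gap′ k

module UpperBound where

  open import Data.Bool using (true; false) renaming (_≟_ to _≟B_; T to True)
  open import Data.Bool.Properties using (T-≡)
  open import Data.Vec using (replicate)
  open import Data.List.Membership.Propositional using (lose)
  open import Data.List.Relation.Unary.Any.Properties using (any⁺)
  open import Data.Nat using (ℕ; _≤_; _<_; _^_; _*_; s≤s; z≤n)
  open import Data.Nat.Properties
  open import Data.Fin using (zero; suc)
  open import Data.List using (List; [])
  open import Data.Fin.Subset using (Subset)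
  open import Data.Bool.ListAction using (all)
  open import Relation.Nullary.Decidable using (does)
  open import Relation.Binary.PropositionalEquality
  open import Function using (_∘_; Equivalence)
  open import Defs
  open FiniteSums
  open Colourings
  open Edges
  open Thirds using (product≤s)

  #rb : ∀ {n} → Colouring n → ℕ
  #rb {n} c = ∑ (threeSets n) (𝟙 ∘ rainbow c)

  #rb≤s : ∀ {n} (c : Colouring n) → #rb c ≤ s n
  #rb≤s {n} c = subst (_≤ s n) (sym (#rainbow c))
    (product≤s n (partSize c zero) (partSize c (suc zero)) (partSize c (suc (suc zero))) (partSizes-sum c))

  T≡∑ : ∀ n → T n ≡ ∑ (threeGraphs n) (𝟙 ∘ isTripartite)
  T≡∑ n = trans (length-filter (λ G → isTripartite G ≟B true) (threeGraphs n))
    (∑-cong (threeGraphs n) (λ G → cong 𝟙 (does≡ (isTripartite G))))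
    where does≡ : ∀ b → does (b ≟B true) ≡ b
          does≡ true  = refl
          does≡ false = refl

  -- Counting pairs (colouring, 3-graph properly coloured by it): each tripartite
  -- 3-graph occurs at least once, the empty 3-graph 3^n times, and a colouring c
  -- properly colours the 2^(#rb c) 3-graphs made of its rainbow edges.
  T<∑2^#rb : ∀ n → 1 ≤ n → T n < ∑ (allColourings n) (λ c → 2 ^ #rb c)
  T<∑2^#rb n 1≤n = begin-strict
    T n                                                                 ≡⟨ T≡∑ n ⟩
    ∑ Gs (𝟙 ∘ isTripartite)                                             <⟨ ∑-mono-< Gs atMostColourings ([]∈sublists (threeSets n)) empty ⟩
    ∑ Gs (λ G → ∑ Cs (λ c → 𝟙 (all (rainbow c) G)))                     ≡⟨ ∑-swap Gs Cs _ ⟩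
    ∑ Cs (λ c → ∑ Gs (𝟙 ∘ all (rainbow c)))                             ≡⟨ ∑-cong Cs (λ c → sublists-all (rainbow c) (threeSets n)) ⟩
    ∑ Cs (λ c → 2 ^ #rb c)                                              ∎
    where
    open ≤-Reasoning
    Gs : List (List (Subset n))
    Gs = threeGraphs n
    Cs : List (Colouring n)
    Cs = allColourings n
    atMostColourings : ∀ G → 𝟙 (isTripartite G) ≤ ∑ Cs (λ c → 𝟙 (all (rainbow c) G))
    atMostColourings G = 𝟙-any≤∑ (λ c → all (rainbow c) G) Cs
    empty : 𝟙 (isTripartite {n} []) < ∑ Cs (λ c → 𝟙 (all (rainbow c) []))
    empty = begin-strict
      𝟙 (isTripartite {n} [])   ≤⟨ 𝟙≤1 _ ⟩
      1                         <⟨ s≤s (s≤s z≤n) ⟩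
      3 ^ 1                     ≤⟨ ^-monoʳ-≤ 3 1≤n ⟩
      3 ^ n                     ≡⟨ sym (trans (∑-colourings-const n 1) (*-identityʳ (3 ^ n))) ⟩
      ∑ Cs (λ _ → 1)            ∎

  T<3^n2^s : ∀ n → 1 ≤ n → T n < 3 ^ n * 2 ^ s n
  T<3^n2^s n 1≤n = <-≤-trans (T<∑2^#rb n 1≤n) (begin
    ∑ (allColourings n) (λ c → 2 ^ #rb c)  ≤⟨ ∑-mono (allColourings n) (λ c → ^-monoʳ-≤ 2 (#rb≤s c)) ⟩
    ∑ (allColourings n) (λ _ → 2 ^ s n)    ≡⟨ ∑-colourings-const n (2 ^ s n) ⟩
    3 ^ n * 2 ^ s n                        ∎)
    where open ≤-Reasoning

  -- The empty 3-graph is tripartite, so T(n) ≥ 1.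
  1≤T : ∀ n → 1 ≤ T n
  1≤T n = begin
    1                          ≡⟨ cong 𝟙 (sym (Equivalence.to T-≡ emptyTripartite)) ⟩
    𝟙 (isTripartite {n} [])    ≤⟨ ∑-member (threeGraphs n) (𝟙 ∘ isTripartite) ([]∈sublists (threeSets n)) ⟩
    ∑ (threeGraphs n) (𝟙 ∘ isTripartite) ≡⟨ sym (T≡∑ n) ⟩
    T n                        ∎
    where
    open ≤-Reasoning
    emptyTripartite : True (isTripartite {n} [])
    emptyTripartite = any⁺ (λ c → all (rainbow c) []) (lose (∈-allColourings (replicate n zero)) _)

module GoodGraphs where

  open import Data.Bool using (Bool; true; false; _∧_; _∨_; not)
  open import Data.Nat
  open import Data.Nat.Properties
  open import Data.Fin using (Fin)
  open import Data.Fin.Properties using () renaming (_≟_ to _≟F_)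
  open import Data.Fin.Subset using (Subset)
  open import Data.Vec using (lookup)
  open import Data.List using (List; []; _∷_; length; map; concatMap; allFin)
  open import Data.List.Properties using (length-tabulate)
  open import Data.List.Membership.Propositional using (_∈_)
  open import Data.List.Membership.Propositional.Properties using (∈-map⁺; ∈-concat⁺′; ∈-allFin)
  open import Data.Bool.ListAction using (all; any)
  open import Data.Product using (_×_; _,_)
  open import Relation.Nullary using (Dec; yes; no)
  open import Relation.Nullary.Decidable using (does; dec-true; dec-false)
  open import Data.Bool.Properties using (∧-zeroʳ)
  open import Relation.Binary.PropositionalEquality
  open import Function using (_∘_)
  open import Defs
  open FiniteSums
  open Colourings
  open Edges
  open UpperBound using (#rb)

  pairs : ∀ n → List (Fin n × Fin n)
  pairs n = concatMap (λ u → map (u ,_) (allFin n)) (allFin n)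

  ∈-pairs : ∀ {n} (u v : Fin n) → (u , v) ∈ pairs n
  ∈-pairs {n} u v = ∈-concat⁺′ (∈-map⁺ (u ,_) (∈-allFin v)) (∈-map⁺ (λ u → map (u ,_) (allFin n)) (∈-allFin u))

  ∑-pairs-const : ∀ n k → ∑ (pairs n) (λ _ → k) ≡ n * n * k
  ∑-pairs-const n k = begin
    ∑ (pairs n) (λ _ → k)                           ≡⟨ ∑-concatMap (λ u → map (u ,_) (allFin n)) (allFin n) (λ _ → k) ⟩
    ∑ (allFin n) (λ u → ∑ (map (u ,_) (allFin n)) (λ _ → k)) ≡⟨ ∑-cong (allFin n) (λ u → trans (∑-map (u ,_) (allFin n) (λ _ → k)) (∑-const (allFin n) k)) ⟩
    ∑ (allFin n) (λ _ → length (allFin n) * k)      ≡⟨ ∑-const (allFin n) _ ⟩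
    length (allFin n) * (length (allFin n) * k)     ≡⟨ cong (λ m → m * (m * k)) (length-tabulate {n = n} (λ i → i)) ⟩
    n * (n * k)                                     ≡⟨ sym (*-assoc n n k) ⟩
    n * n * k                                       ∎
    where open ≡-Reasoning

  covered : ∀ {n} → Fin n → Fin n → List (Subset n) → Bool
  covered u v G = any (λ e → lookup e u ∧ lookup e v) G

  linked : ∀ {n} → Colouring n → List (Subset n) → Fin n × Fin n → Bool
  linked c G (u , v) = does (lookup c u ≟F lookup c v) ∨ covered u v G

  -- G is good for c: c properly colours G, and any two vertices in different
  -- parts of c lie in a common edge.  Such a G determines its parts (see Rigidity).
  good : ∀ {n} → Colouring n → List (Subset n) → Bool
  good {n} c G = all (rainbow c) G ∧ all (linked c G) (pairs n)

  #good : ∀ {n} → Colouring n → ℕ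
  #good {n} c = ∑ (threeGraphs n) (𝟙 ∘ good c)

  unlinked : ∀ {n} → Colouring n → List (Subset n) → Fin n × Fin n → Bool
  unlinked c G uv = all (rainbow c) G ∧ not (linked c G uv)

  all∧¬any : ∀ {A : Set} (p q : A → Bool) (G : List A) → all p G ∧ not (any q G) ≡ all (λ e → p e ∧ not (q e)) G
  all∧¬any p q [] = refl
  all∧¬any p q (e ∷ G) with p e | q e
  ... | true  | true  = ∧-zeroʳ _
  ... | true  | false = all∧¬any p q G
  ... | false | _     = refl

  -- For u, v in different parts, the properly coloured 3-graphs missing (u, v) are
  -- those avoiding the edges through u and v, of which there are as many as
  -- vertices in the third part.
  #unlinked : ∀ {n} (c : Colouring n) (u v : Fin n) → lookup c u ≢ lookup c v →
    ∑ (threeGraphs n) (λ G → 𝟙 (unlinked c G (u , v))) * 2 ^ partSize c (third (lookup c u) (lookup c v)) ≡ 2 ^ #rb c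
  #unlinked {n} c u v cu≢cv = begin
    ∑ (threeGraphs n) (λ G → 𝟙 (unlinked c G (u , v))) * 2 ^ t
      ≡⟨ cong (_* 2 ^ t) (∑-cong (threeGraphs n) (λ G → cong 𝟙 (trans
           (cong (λ b → all (rainbow c) G ∧ not (b ∨ covered u v G)) (dec-false (lookup c u ≟F lookup c v) cu≢cv))
           (all∧¬any (rainbow c) (λ e → lookup e u ∧ lookup e v) G)))) ⟩
    ∑ (threeGraphs n) (𝟙 ∘ all avoiding) * 2 ^ t     ≡⟨ cong (_* 2 ^ t) (sublists-all avoiding (threeSets n)) ⟩
    2 ^ #avoiding * 2 ^ t                             ≡⟨ sym (^-distribˡ-+-* 2 #avoiding t) ⟩
    2 ^ (#avoiding + t)                               ≡⟨ cong (2 ^_) split ⟩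
    2 ^ #rb c                                         ∎
    where
    open ≡-Reasoning
    t : ℕ
    t = partSize c (third (lookup c u) (lookup c v))
    avoiding : Subset n → Bool
    avoiding e = rainbow c e ∧ not (lookup e u ∧ lookup e v)
    #avoiding : ℕ
    #avoiding = ∑ (threeSets n) (𝟙 ∘ avoiding)
    pointwise : ∀ r a b → 𝟙 (r ∧ not (a ∧ b)) + 𝟙 (a ∧ (b ∧ r)) ≡ 𝟙 r
    pointwise true  true  true  = refl
    pointwise true  true  false = refl
    pointwise true  false b     = refl
    pointwise false true  true  = refl
    pointwise false true  false = refl
    pointwise false false b     = refl
    split : #avoiding + t ≡ #rb c
    split = trans (cong (#avoiding +_) (sym (#rainbow-through c u v cu≢cv)))
      (trans (sym (∑-+ (threeSets n) _ _)) (∑-cong (threeSets n) (λ e → pointwise (rainbow c e) (lookup e u) (lookup e v))))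

  unlinked-same : ∀ {n} (c : Colouring n) (u v : Fin n) → lookup c u ≡ lookup c v → ∀ G → 𝟙 (unlinked c G (u , v)) ≡ 0
  unlinked-same c u v cu≡cv G rewrite cu≡cv | dec-true (lookup c v ≟F lookup c v) refl = cong 𝟙 (∧-zeroʳ _)

  #unlinked-at : ∀ {n} → Colouring n → Fin n × Fin n → ℕ
  #unlinked-at {n} c uv = ∑ (threeGraphs n) (λ G → 𝟙 (unlinked c G uv))

  2^#rb≤#good+∑unlinked : ∀ {n} (c : Colouring n) → 2 ^ #rb c ≤ #good c + ∑ (pairs n) (#unlinked-at c)
  2^#rb≤#good+∑unlinked {n} c = begin
    2 ^ #rb c                                              ≡⟨ sym (sublists-all (rainbow c) (threeSets n)) ⟩
    ∑ Gs (𝟙 ∘ all (rainbow c))                             ≤⟨ ∑-mono Gs (λ G → union-bound (all (rainbow c) G) (linked c G) (pairs n)) ⟩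
    ∑ Gs (λ G → 𝟙 (good c G) + ∑ (pairs n) (λ uv → 𝟙 (unlinked c G uv))) ≡⟨ ∑-+ Gs _ _ ⟩
    #good c + ∑ Gs (λ G → ∑ (pairs n) (λ uv → 𝟙 (unlinked c G uv)))     ≡⟨ cong (#good c +_) (∑-swap Gs (pairs n) _) ⟩
    #good c + ∑ (pairs n) (#unlinked-at c)                 ∎
    where
    open ≤-Reasoning
    Gs : List (List (Subset n))
    Gs = threeGraphs n

  2^k*#unlinked≤2^#rb : ∀ {n} (c : Colouring n) k → (∀ x → k ≤ partSize c x) → ∀ uv → 2 ^ k * #unlinked-at c uv ≤ 2 ^ #rb c
  2^k*#unlinked≤2^#rb {n} c k k≤parts (u , v) = byParts (lookup c u ≟F lookup c v)
    where
    open ≤-Reasoning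
    t : ℕ
    t = partSize c (third (lookup c u) (lookup c v))
    byParts : Dec (lookup c u ≡ lookup c v) → 2 ^ k * #unlinked-at c (u , v) ≤ 2 ^ #rb c
    byParts (yes cu≡cv) = begin
      2 ^ k * #unlinked-at c (u , v)   ≡⟨ cong (2 ^ k *_) (∑-zero (threeGraphs n) (unlinked-same c u v cu≡cv)) ⟩
      2 ^ k * 0                        ≡⟨ *-zeroʳ (2 ^ k) ⟩
      0                                ≤⟨ z≤n ⟩
      2 ^ #rb c                        ∎
    byParts (no cu≢cv) = begin
      2 ^ k * #unlinked-at c (u , v)   ≤⟨ *-monoˡ-≤ (#unlinked-at c (u , v)) (^-monoʳ-≤ 2 (k≤parts (third (lookup c u) (lookup c v)))) ⟩
      2 ^ t * #unlinked-at c (u , v)   ≡⟨ *-comm (2 ^ t) _ ⟩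
      #unlinked-at c (u , v) * 2 ^ t   ≡⟨ #unlinked c u v cu≢cv ⟩
      2 ^ #rb c                        ∎

  #good-bound : ∀ {n} (c : Colouring n) k → (∀ x → k ≤ partSize c x) →
    2 ^ k * 2 ^ #rb c ≤ 2 ^ k * #good c + n * n * 2 ^ #rb c
  #good-bound {n} c k k≤parts = begin
    2 ^ k * 2 ^ #rb c                                              ≤⟨ *-monoʳ-≤ (2 ^ k) (2^#rb≤#good+∑unlinked c) ⟩
    2 ^ k * (#good c + ∑ (pairs n) (#unlinked-at c))               ≡⟨ *-distribˡ-+ (2 ^ k) _ _ ⟩
    2 ^ k * #good c + 2 ^ k * ∑ (pairs n) (#unlinked-at c)         ≡⟨ cong (2 ^ k * #good c +_) (sym (∑-*ˡ (pairs n) (2 ^ k) _)) ⟩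
    2 ^ k * #good c + ∑ (pairs n) (λ uv → 2 ^ k * #unlinked-at c uv) ≤⟨ +-monoʳ-≤ (2 ^ k * #good c) (∑-mono (pairs n) (2^k*#unlinked≤2^#rb c k k≤parts)) ⟩
    2 ^ k * #good c + ∑ (pairs n) (λ _ → 2 ^ #rb c)                ≡⟨ cong (2 ^ k * #good c +_) (∑-pairs-const n (2 ^ #rb c)) ⟩
    2 ^ k * #good c + n * n * 2 ^ #rb c                            ∎
    where open ≤-Reasoning

module Rigidity where

  open import Data.Bool using (Bool; true; _∧_; _∨_) renaming (T to True)
  open import Data.Bool.Properties using (T-∧; T-≡) renaming (T? to True?)
  open import Data.Nat using (ℕ; _≤_; z≤n; s≤s; _*_)
  open import Data.Nat.Properties using (≤-trans; m≤n+m; <⇒≱; ≤-reflexive; n<1+n; module ≤-Reasoning)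
  open import Data.Fin using (Fin; zero; suc)
  open import Data.Fin.Properties using (pigeonhole) renaming (_≟_ to _≟F_; <-irrefl to <-irreflF)
  open import Data.Fin.Subset using (Subset)
  open import Data.Vec using (Vec; _∷_; lookup; tabulate; map)
  open import Data.Vec.Properties using (lookup-map; lookup∘tabulate; tabulate∘lookup; tabulate-cong)
  open import Data.Vec.Relation.Unary.Unique.Propositional using (Unique)
  open import Data.Vec.Relation.Unary.Unique.Propositional.Properties using (lookup-injective; tabulate⁺)
  open import Data.Vec.Relation.Unary.AllPairs using (allPairs?)
  open import Data.List using (List; filter; length)
  open import Data.List.Membership.Propositional using (_∈_; find; lose)
  open import Data.List.Membership.Propositional.Properties using (∈-filter⁺)
  import Data.List.Relation.Unary.All as All
  open import Data.List.Relation.Unary.All.Properties using (all⁺)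
  open import Data.List.Relation.Unary.Any.Properties using (any⁻; any⁺)
  open import Data.List.Relation.Unary.Any using (Any; any?)
  open import Data.Bool.ListAction using (all; any)
  open import Data.Product using (∃-syntax; _×_; _,_; proj₁; proj₂)
  open import Data.Empty using (⊥-elim)
  open import Relation.Nullary using (Dec; yes; no; ¬?)
  open import Relation.Nullary.Decidable using (does; dec-true; dec-false)
  open import Relation.Binary.PropositionalEquality
  open import Function using (_∘_; Equivalence)
  open import Defs
  open FiniteSums
  open Colourings
  open Edges
  open UpperBound using (T≡∑)
  open GoodGraphs

  1≤countIn : ∀ {n} (c : Colouring n) (e : Subset n) v → True (lookup e v) → 1 ≤ countIn c e (lookup c v)
  1≤countIn (x ∷ c) (true ∷ e) zero _ rewrite dec-true (x ≟F x) refl = s≤s z≤n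
  1≤countIn (x ∷ c) (b ∷ e) (suc v) h = ≤-trans (1≤countIn c e v h) (m≤n+m _ _)

  2≤countIn : ∀ {n} (c : Colouring n) (e : Subset n) u v → u ≢ v → True (lookup e u) → True (lookup e v) →
    lookup c u ≡ lookup c v → 2 ≤ countIn c e (lookup c u)
  2≤countIn (x ∷ c) (b ∷ e) zero    zero    u≢v _  _  _ = ⊥-elim (u≢v refl)
  2≤countIn (x ∷ c) (true ∷ e) zero (suc v) _ _  hv x≡cv rewrite dec-true (x ≟F x) refl | x≡cv = s≤s (1≤countIn c e v hv)
  2≤countIn (x ∷ c) (true ∷ e) (suc u) zero _ hu _ cu≡x rewrite sym cu≡x | dec-true (lookup c u ≟F lookup c u) refl = s≤s (1≤countIn c e u hu)
  2≤countIn (x ∷ c) (b ∷ e) (suc u) (suc v) u≢v hu hv cu≡cv =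
    ≤-trans (2≤countIn c e u v (u≢v ∘ cong suc) hu hv cu≡cv) (m≤n+m _ _)

  good⇒covered : ∀ {n} (c₀ : Colouring n) (G : List (Subset n)) → True (good c₀ G) →
    ∀ u v → lookup c₀ u ≢ lookup c₀ v → True (covered u v G)
  good⇒covered {n} c₀ G good₀ u v c₀u≢c₀v =
    subst (λ b → True (b ∨ covered u v G)) (dec-false (lookup c₀ u ≟F lookup c₀ v) c₀u≢c₀v) linked₀
    where
    linked₀ : True (linked c₀ G (u , v))
    linked₀ = All.lookup (all⁺ (linked c₀ G) (pairs n) (proj₂ (Equivalence.to (T-∧ {all (rainbow c₀) G}) good₀))) (∈-pairs u v)

  -- If G is good for c₀ and c properly colours G, then c separates any two
  -- vertices that c₀ separates: they lie in a common edge, which is rainbow for c.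
  separation : ∀ {n} (c₀ c : Colouring n) (G : List (Subset n)) → True (good c₀ G) → True (all (rainbow c) G) →
    ∀ u v → lookup c₀ u ≢ lookup c₀ v → lookup c u ≢ lookup c v
  separation c₀ c G good₀ proper u v c₀u≢c₀v cu≡cv
    with find (any⁻ (λ e → lookup e u ∧ lookup e v) G (good⇒covered c₀ G good₀ u v c₀u≢c₀v))
  ... | e , e∈G , uv∈e = <⇒≱ (n<1+n 1) (begin
    2                          ≤⟨ 2≤countIn c e u v (c₀u≢c₀v ∘ cong (lookup c₀)) u∈e v∈e cu≡cv ⟩
    countIn c e (lookup c u)   ≡⟨ rainbow⇒once c e (All.lookup (all⁺ (rainbow c) G proper) e∈G) (lookup c u) ⟩
    1                          ∎)
    where
    open ≤-Reasoning
    u∈e : True (lookup e u)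
    u∈e = proj₁ (Equivalence.to (T-∧ {lookup e u}) uv∈e)
    v∈e : True (lookup e v)
    v∈e = proj₂ (Equivalence.to (T-∧ {lookup e u}) uv∈e)

  -- The permutations of the three colours, as repetition-free vectors; only
  -- the two facts below about this list are used.
  abstract
    permutations : List (Vec (Fin 3) 3)
    permutations = filter (allPairs? (λ x y → ¬? (x ≟F y))) (allColourings 3)

    ∈-permutations : ∀ {π} → Unique π → π ∈ permutations
    ∈-permutations uπ = ∈-filter⁺ (allPairs? (λ x y → ¬? (x ≟F y))) (∈-allColourings _) uπ

    #permutations : length permutations ≡ 6
    #permutations = refl

  -- For a permutation π, a colour y different from π j for all j ≠ k is π k
  -- (pigeonhole: y and π would be four distinct colours).
  permutation-avoid : ∀ {π : Vec (Fin 3) 3} → Unique π → ∀ k y → (∀ j → j ≢ k → y ≢ lookup π j) → y ≡ lookup π k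
  permutation-avoid {π} uπ k y avoid with pigeonhole (n<1+n 3) (lookup (y ∷ π))
  ... | zero  , suc j , _ , y≡πj with j ≟F k
  ...   | yes refl = y≡πj
  ...   | no j≢k   = ⊥-elim (avoid j j≢k y≡πj)
  permutation-avoid {π} uπ k y avoid | suc i , suc j , s≤s i<j , πi≡πj = ⊥-elim (<-irreflF (lookup-injective uπ i j πi≡πj) i<j)

  representative : ∀ {n} (c : Colouring n) k → 1 ≤ partSize c k → ∃[ x ] lookup c x ≡ k
  representative (y ∷ c) k h with y ≟F k
  ... | yes y≡k = zero , y≡k
  ... | no  _   = let x , cx≡k = representative c k h in suc x , cx≡k

  rigidity : ∀ {n} (c₀ c : Colouring n) (G : List (Subset n)) → True (good c₀ G) → True (all (rainbow c) G) →
    (∀ k → 1 ≤ partSize c₀ k) → ∃[ π ] (π ∈ permutations × c ≡ map (lookup π) c₀)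
  rigidity {n} c₀ c G good₀ proper nonempty =
    π , ∈-permutations π-unique , c≡πc₀
    where
    sep : ∀ u v → lookup c₀ u ≢ lookup c₀ v → lookup c u ≢ lookup c v
    sep = separation c₀ c G good₀ proper
    x : Fin 3 → Fin n
    x k = proj₁ (representative c₀ k (nonempty k))
    c₀x≡ : ∀ k → lookup c₀ (x k) ≡ k
    c₀x≡ k = proj₂ (representative c₀ k (nonempty k))
    -- π sends each colour k to the c-colour of a representative of part k of c₀.
    π : Vec (Fin 3) 3
    π = tabulate (λ k → lookup c (x k))
    π-unique : Unique π
    π-unique = tabulate⁺ injective
      where
      injective : ∀ {i j} → lookup c (x i) ≡ lookup c (x j) → i ≡ j
      injective {i} {j} eq with i ≟F j
      ... | yes i≡j = i≡j
      ... | no  i≢j = ⊥-elim (sep (x i) (x j) (λ e → i≢j (trans (sym (c₀x≡ i)) (trans e (c₀x≡ j)))) eq)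
    pointwise : ∀ u → lookup c u ≡ lookup (map (lookup π) c₀) u
    pointwise u = trans (permutation-avoid π-unique (lookup c₀ u) (lookup c u) avoid) (sym (lookup-map u (lookup π) c₀))
      where
      avoid : ∀ j → j ≢ lookup c₀ u → lookup c u ≢ lookup π j
      avoid j j≢c₀u cu≡πj = sep u (x j) (λ e → j≢c₀u (trans (sym (c₀x≡ j)) (sym e)))
        (trans cu≡πj (lookup∘tabulate (λ k → lookup c (x k)) j))
    c≡πc₀ : c ≡ map (lookup π) c₀
    c≡πc₀ = trans (sym (tabulate∘lookup c)) (trans (tabulate-cong pointwise) (tabulate∘lookup (map (lookup π) c₀)))

  good⇒tripartite : ∀ {n} (c : Colouring n) (G : List (Subset n)) → True (good c G) → True (isTripartite G)
  good⇒tripartite {n} c G good-c =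
    any⁺ (λ d → all (rainbow d) G) (lose (∈-allColourings c) (proj₁ (Equivalence.to (T-∧ {all (rainbow c) G}) good-c)))

  isPermuted : ∀ {n} → Colouring n → Colouring n → Vec (Fin 3) 3 → ℕ
  isPermuted c₀ c π = 𝟙 (does (c ≟C map (lookup π) c₀))

  isPermuted-at : ∀ {n} {c₀ c : Colouring n} π → c ≡ map (lookup π) c₀ → isPermuted c₀ c π ≡ 1
  isPermuted-at {c₀ = c₀} {c} π c≡πc₀ = cong 𝟙 (dec-true (c ≟C map (lookup π) c₀) c≡πc₀)

  good⇒permuted : ∀ {n} (c₀ : Colouring n) (G : List (Subset n)) → True (good c₀ G) → (∀ k → 1 ≤ partSize c₀ k) →
    ∀ c → 𝟙 (good c G) ≤ ∑ permutations (isPermuted c₀ c)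
  good⇒permuted c₀ G good₀ nonempty c = 𝟙≤ (good c G) permuted
    where
    permuted : True (good c G) → 1 ≤ ∑ permutations (isPermuted c₀ c)
    permuted good-c =
      let π , π∈ , c≡πc₀ = rigidity c₀ c G good₀ (proj₁ (Equivalence.to (T-∧ {all (rainbow c) G}) good-c)) nonempty
      in ≤-trans (≤-reflexive (sym (isPermuted-at π c≡πc₀))) (∑-member permutations (isPermuted c₀ c) π∈)

  #permuted : ∀ {n} (c₀ : Colouring n) → ∑ (allColourings n) (λ c → ∑ permutations (isPermuted c₀ c)) ≡ 6
  #permuted {n} c₀ = begin
    ∑ (allColourings n) (λ c → ∑ permutations (isPermuted c₀ c))  ≡⟨ ∑-swap (allColourings n) permutations (isPermuted c₀) ⟩
    ∑ permutations (λ π → ∑ (allColourings n) (λ c → isPermuted c₀ c π)) ≡⟨ ∑-cong permutations (λ π → ∑-colourings-≟ (map (lookup π) c₀)) ⟩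
    ∑ permutations (λ _ → 1)                                      ≡⟨ ∑-const permutations 1 ⟩
    length permutations * 1                             ≡⟨ cong (_* 1) #permutations ⟩
    6                                                             ∎
    where open ≡-Reasoning

  #good-colourings≤6 : ∀ {n} (b : Colouring n → Bool) → (∀ c → True (b c) → ∀ k → 1 ≤ partSize c k) →
    ∀ G → ∑ (allColourings n) (λ c → 𝟙 (b c ∧ good c G)) ≤ 6 * 𝟙 (isTripartite G)
  #good-colourings≤6 {n} b nonempty G = byWitness (any? (True? ∘ q) Cs)
    where
    open ≤-Reasoning
    Cs : List (Colouring n)
    Cs = allColourings n
    q : Colouring n → Bool
    q c = b c ∧ good c G
    byWitness : Dec (Any (True ∘ q) Cs) → ∑ Cs (𝟙 ∘ q) ≤ 6 * 𝟙 (isTripartite G)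
    byWitness (no none) = ≤-trans (≤-reflexive (∑-zero Cs (λ c → 𝟙-false (q c) (none ∘ lose (∈-allColourings c))))) z≤n
    byWitness (yes some) =
      let c₀ , _ , q₀ = find some
          b₀ , good₀ = Equivalence.to (T-∧ {b c₀}) q₀
      in begin
        ∑ Cs (𝟙 ∘ q)                                         ≤⟨ ∑-mono Cs (λ c → 𝟙-∧≤ʳ (b c) (good c G)) ⟩
        ∑ Cs (λ c → 𝟙 (good c G))                            ≤⟨ ∑-mono Cs (good⇒permuted c₀ G good₀ (nonempty c₀ b₀)) ⟩
        ∑ Cs (λ c → ∑ permutations (isPermuted c₀ c))         ≡⟨ #permuted c₀ ⟩
        6                                                    ≡⟨ cong (λ t → 6 * 𝟙 t) (sym (Equivalence.to T-≡ (good⇒tripartite c₀ G good₀))) ⟩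
        6 * 𝟙 (isTripartite G)                               ∎

  ∑#good≤6T : ∀ {n} (b : Colouring n → Bool) → (∀ c → True (b c) → ∀ k → 1 ≤ partSize c k) →
    ∑ (allColourings n) (λ c → 𝟙 (b c) * #good c) ≤ 6 * T n
  ∑#good≤6T {n} b nonempty = begin
    ∑ Cs (λ c → 𝟙 (b c) * #good c)                     ≡⟨ ∑-cong Cs (λ c → sym (∑-*ˡ Gs (𝟙 (b c)) (𝟙 ∘ good c))) ⟩
    ∑ Cs (λ c → ∑ Gs (λ G → 𝟙 (b c) * 𝟙 (good c G)))   ≡⟨ ∑-cong Cs (λ c → ∑-cong Gs (λ G → sym (𝟙-∧ (b c) (good c G)))) ⟩
    ∑ Cs (λ c → ∑ Gs (λ G → 𝟙 (b c ∧ good c G)))       ≡⟨ ∑-swap Cs Gs (λ c G → 𝟙 (b c ∧ good c G)) ⟩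
    ∑ Gs (λ G → ∑ Cs (λ c → 𝟙 (b c ∧ good c G)))       ≤⟨ ∑-mono Gs (#good-colourings≤6 b nonempty) ⟩
    ∑ Gs (λ G → 6 * 𝟙 (isTripartite G))                ≡⟨ ∑-*ˡ Gs 6 (𝟙 ∘ isTripartite) ⟩
    6 * ∑ Gs (𝟙 ∘ isTripartite)                        ≡⟨ cong (6 *_) (sym (T≡∑ n)) ⟩
    6 * T n                                            ∎
    where
    open ≤-Reasoning
    Cs : List (Colouring n)
    Cs = allColourings n
    Gs : List (List (Subset n))
    Gs = threeGraphs n

module LowerBound where

  open import Data.Bool using (Bool) renaming (T to True)
  open import Data.Bool.Properties using (T-∧)
  open import Data.Nat
  open import Data.Nat.Properties
  open import Data.Nat.DivMod using (_/_; /-monoˡ-≤; m*n/n≡m; m≥n⇒m/n>0)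
  open import Data.Fin using (zero; suc)
  open import Data.List using (List)
  open import Relation.Binary.PropositionalEquality
  open import Function using (_∘_; Equivalence)
  open import Data.Product using (_×_; _,_; proj₁; proj₂)
  open import Data.Nat.Tactic.RingSolver using (solve-∀)
  open import Defs
  open FiniteSums
  open Colourings
  open Edges using (#rainbow)
  open Thirds using (floors-sum)
  open UpperBound using (#rb)
  open GoodGraphs using (#good; #good-bound)
  open Rigidity using (∑#good≤6T)

  module _ (n : ℕ) where

    A B D : ℕ
    A = (n + 2) / 3
    B = (n + 1) / 3
    D = n / 3

    balanced : Colouring n → Bool
    balanced c = hasSizes c A B D

    M≡#balanced : M n ≡ #withSizes n A B D
    M≡#balanced = trans (cong (_/ (A ! * B ! * D !)) (sym (#withSizes-multinomial n A B D (floors-sum n))))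
                        (m*n/n≡m (#withSizes n A B D) (A ! * B ! * D !))
      where instance _ = m*n≢0 (A ! * B !) (D !) {{m*n≢0 (A !) (B !) {{A !≢0}} {{B !≢0}}}} {{D !≢0}}

    balanced-sizes : ∀ c → True (balanced c) →
      partSize c zero ≡ A × partSize c (suc zero) ≡ B × partSize c (suc (suc zero)) ≡ D
    balanced-sizes c h =
      let h₀ , h₁₂ = Equivalence.to (T-∧ {partSize c zero ≡ᵇ A}) h
          h₁ , h₂  = Equivalence.to (T-∧ {partSize c (suc zero) ≡ᵇ B}) h₁₂
      in ≡ᵇ⇒≡ _ A h₀ , ≡ᵇ⇒≡ _ B h₁ , ≡ᵇ⇒≡ _ D h₂

    balanced⇒D≤parts : ∀ c → True (balanced c) → ∀ k → D ≤ partSize c k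
    balanced⇒D≤parts c h zero             = subst (D ≤_) (sym (proj₁ (balanced-sizes c h))) (/-monoˡ-≤ 3 (m≤m+n n 2))
    balanced⇒D≤parts c h (suc zero)       = subst (D ≤_) (sym (proj₁ (proj₂ (balanced-sizes c h)))) (/-monoˡ-≤ 3 (m≤m+n n 1))
    balanced⇒D≤parts c h (suc (suc zero)) = ≤-reflexive (sym (proj₂ (proj₂ (balanced-sizes c h))))

    balanced⇒#rb≡s : ∀ c → True (balanced c) → #rb c ≡ s n
    balanced⇒#rb≡s c h = let a , b , d = balanced-sizes c h in
      trans (#rainbow c) (trans (cong₂ _*_ (cong₂ _*_ a b) d) (reverse A B D))
      where reverse : ∀ a b d → a * b * d ≡ d * b * a
            reverse = solve-∀

    -- The main inequality of the lower bound, summing #good-bound over the balanced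
    -- colourings and double counting the good 3-graphs (n ≥ 3, so parts are nonempty):
    --   2^D · M(n) 2^s(n) ≤ 2^D · 6 T(n) + n² · M(n) 2^s(n).
    lower-bound : 3 ≤ n → 2 ^ D * (M n * 2 ^ s n) ≤ 2 ^ D * (6 * T n) + n * n * (M n * 2 ^ s n)
    lower-bound 3≤n = begin
      2 ^ D * (M n * 2 ^ s n)                                   ≡⟨ cong (λ m → 2 ^ D * (m * 2 ^ s n)) M≡#balanced ⟩
      2 ^ D * (#bal * 2 ^ s n)                                  ≡⟨ regroup (2 ^ D) #bal (2 ^ s n) ⟩
      ∑ Cs (𝟙 ∘ balanced) * (2 ^ D * 2 ^ s n)                   ≡⟨ sym (∑-*ʳ Cs (𝟙 ∘ balanced) (2 ^ D * 2 ^ s n)) ⟩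
      ∑ Cs (λ c → 𝟙 (balanced c) * (2 ^ D * 2 ^ s n))           ≤⟨ ∑-mono Cs (λ c → 𝟙*-mono (balanced c) (mostlyGood c)) ⟩
      ∑ Cs (λ c → 𝟙 (balanced c) * (2 ^ D * #good c + E))       ≡⟨ ∑-cong Cs (λ c → spread (𝟙 (balanced c)) (2 ^ D) (#good c) E) ⟩
      ∑ Cs (λ c → 2 ^ D * (𝟙 (balanced c) * #good c) + 𝟙 (balanced c) * E)
        ≡⟨ trans (∑-+ Cs _ _) (cong₂ _+_ (∑-*ˡ Cs (2 ^ D) _) (∑-*ʳ Cs (𝟙 ∘ balanced) E)) ⟩
      2 ^ D * ∑ Cs (λ c → 𝟙 (balanced c) * #good c) + #bal * E  ≤⟨ +-monoˡ-≤ (#bal * E) (*-monoʳ-≤ (2 ^ D) (∑#good≤6T balanced nonempty)) ⟩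
      2 ^ D * (6 * T n) + #bal * E                              ≡⟨ cong (λ m → 2 ^ D * (6 * T n) + m * E) (sym M≡#balanced) ⟩
      2 ^ D * (6 * T n) + M n * (n * n * 2 ^ s n)               ≡⟨ cong (2 ^ D * (6 * T n) +_) (swap (M n) (n * n) (2 ^ s n)) ⟩
      2 ^ D * (6 * T n) + n * n * (M n * 2 ^ s n)               ∎
      where
      open ≤-Reasoning
      Cs : List (Colouring n)
      Cs = allColourings n
      #bal : ℕ
      #bal = #withSizes n A B D
      E : ℕ
      E = n * n * 2 ^ s n
      regroup : ∀ p m q → p * (m * q) ≡ m * (p * q)
      regroup = solve-∀
      spread : ∀ i p g e → i * (p * g + e) ≡ p * (i * g) + i * e
      spread = solve-∀
      swap : ∀ m a q → m * (a * q) ≡ a * (m * q)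
      swap = solve-∀
      nonempty : ∀ c → True (balanced c) → ∀ k → 1 ≤ partSize c k
      nonempty c h k = ≤-trans (m≥n⇒m/n>0 3≤n) (balanced⇒D≤parts c h k)
      mostlyGood : ∀ c → True (balanced c) → 2 ^ D * 2 ^ s n ≤ 2 ^ D * #good c + E
      mostlyGood c h = subst (λ r → 2 ^ D * 2 ^ r ≤ 2 ^ D * #good c + n * n * 2 ^ r) (balanced⇒#rb≡s c h)
        (#good-bound c D (balanced⇒D≤parts c h))

module MultinomialBound where

  open import Data.Nat
  open import Data.Nat.Properties
  open import Data.Nat.DivMod using (_/_; m<n⇒m/n≡0)
  open import Relation.Binary.PropositionalEquality
  open import Relation.Nullary using (contradiction)
  open import Data.Nat.Tactic.RingSolver using (solve-∀)
  open import Defs using (M)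
  open Colourings using (#withSizes-multinomial)
  open Thirds using (Mod3; ≡0; ≡1; ≡2; mod3; [3m+t]/3≡m+t/3; floors-sum)
  open LowerBound using (A; B; D; M≡#balanced)

  open ≤-Reasoning

  [3m+3]!≡ : ∀ m → (3 * suc m) ! ≡ (3 * m + 3) * ((3 * m + 2) * ((3 * m + 1) * (3 * m) !))
  [3m+3]!≡ m = trans (cong _! (unfold m)) (cong₂ _*_ (e₃ m) (cong₂ _*_ (e₂ m) (cong (_* (3 * m) !) (e₁ m))))
    where unfold : ∀ m → 3 * suc m ≡ suc (suc (suc (3 * m)))
          unfold = solve-∀
          e₃ : ∀ m → suc (suc (suc (3 * m))) ≡ 3 * m + 3
          e₃ = solve-∀
          e₂ : ∀ m → suc (suc (3 * m)) ≡ 3 * m + 2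
          e₂ = solve-∀
          e₁ : ∀ m → suc (3 * m) ≡ 3 * m + 1
          e₁ = solve-∀

  27^m[m!]³≤[3m]![3m+1]² : ∀ m → 27 ^ m * (m ! * m ! * m !) ≤ (3 * m) ! * ((3 * m + 1) * (3 * m + 1))
  27^m[m!]³≤[3m]![3m+1]² zero = ≤-refl
  27^m[m!]³≤[3m]![3m+1]² (suc m) = begin
    27 ^ suc m * (suc m ! * suc m ! * suc m !)                            ≡⟨ peel m (27 ^ m) (m !) ⟩
    27 * (suc m * suc m * suc m) * (27 ^ m * (m ! * m ! * m !))           ≤⟨ *-monoʳ-≤ (27 * (suc m * suc m * suc m)) (27^m[m!]³≤[3m]![3m+1]² m) ⟩
    27 * (suc m * suc m * suc m) * ((3 * m) ! * ((3 * m + 1) * (3 * m + 1)))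
      ≤⟨ m≤m+n _ (3 * (3 * m + 1) * (m + 1) * (27 * m * m + 51 * m + 23) * (3 * m) !) ⟩
    27 * (suc m * suc m * suc m) * ((3 * m) ! * ((3 * m + 1) * (3 * m + 1))) + 3 * (3 * m + 1) * (m + 1) * (27 * m * m + 51 * m + 23) * (3 * m) !
      ≡⟨ identity m ((3 * m) !) ⟩
    (3 * m + 3) * ((3 * m + 2) * ((3 * m + 1) * (3 * m) !)) * ((3 * m + 4) * (3 * m + 4))
      ≡⟨ cong₂ _*_ (sym ([3m+3]!≡ m)) (shift m) ⟩
    (3 * suc m) ! * ((3 * suc m + 1) * (3 * suc m + 1))                   ∎
    where
    peel : ∀ m y f → 27 * y * (suc m * f * (suc m * f) * (suc m * f)) ≡ 27 * (suc m * suc m * suc m) * (y * (f * f * f))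
    peel = solve-∀
    identity : ∀ m G → 27 * (suc m * suc m * suc m) * (G * ((3 * m + 1) * (3 * m + 1))) + 3 * (3 * m + 1) * (m + 1) * (27 * m * m + 51 * m + 23) * G
                     ≡ (3 * m + 3) * ((3 * m + 2) * ((3 * m + 1) * G)) * ((3 * m + 4) * (3 * m + 4))
    identity = solve-∀
    shift : ∀ m → (3 * m + 4) * (3 * m + 4) ≡ (3 * suc m + 1) * (3 * suc m + 1)
    shift = solve-∀

  3^n·A!B!D!≤n!·9[n+1]² : ∀ n → 3 ^ n * (A n ! * B n ! * D n !) ≤ n ! * (9 * ((n + 1) * (n + 1)))
  3^n·A!B!D!≤n!·9[n+1]² n = byResidue (mod3 n)
    where
    small : ∀ m t → t < 3 → (3 * m + t) / 3 ≡ m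
    small m t t<3 = trans ([3m+t]/3≡m+t/3 m t) (trans (cong (m +_) (m<n⇒m/n≡0 t<3)) (+-identityʳ m))
    large : ∀ m r t → (r + t) / 3 ≡ 1 → (3 * m + r + t) / 3 ≡ suc m
    large m r t [r+t]/3≡1 = trans (cong (_/ 3) (+-assoc (3 * m) r t))
      (trans ([3m+t]/3≡m+t/3 m (r + t)) (trans (cong (m +_) [r+t]/3≡1) (+-comm m 1)))
    small' : ∀ m r t → r + t < 3 → (3 * m + r + t) / 3 ≡ m
    small' m r t p = trans (cong (_/ 3) (+-assoc (3 * m) r t)) (small m (r + t) p)
    3m/3 : ∀ m → 3 * m / 3 ≡ m
    3m/3 m = trans (cong (_/ 3) (sym (+-identityʳ (3 * m)))) (small m 0 (s≤s z≤n))
    byResidue : ∀ {n} → Mod3 n → 3 ^ n * (A n ! * B n ! * D n !) ≤ n ! * (9 * ((n + 1) * (n + 1)))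
    byResidue (≡0 m) rewrite small m 2 (s≤s (s≤s (s≤s z≤n))) | small m 1 (s≤s (s≤s z≤n)) | 3m/3 m = begin
      3 ^ (3 * m) * (m ! * m ! * m !)              ≡⟨ cong (_* (m ! * m ! * m !)) (sym (^-*-assoc 3 3 m)) ⟩
      27 ^ m * (m ! * m ! * m !)                   ≤⟨ 27^m[m!]³≤[3m]![3m+1]² m ⟩
      (3 * m) ! * ((3 * m + 1) * (3 * m + 1))       ≤⟨ *-monoʳ-≤ ((3 * m) !) (m≤n*m _ 9) ⟩
      (3 * m) ! * (9 * ((3 * m + 1) * (3 * m + 1))) ∎
    byResidue (≡1 m) rewrite large m 1 2 refl | small' m 1 1 (s≤s (s≤s (s≤s z≤n))) | small m 1 (s≤s (s≤s z≤n)) = begin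
      3 ^ (3 * m + 1) * (suc m ! * m ! * m !)                  ≡⟨ cong (_* (suc m ! * m ! * m !)) (^-distribˡ-+-* 3 (3 * m) 1) ⟩
      3 ^ (3 * m) * 3 ^ 1 * (suc m ! * m ! * m !)              ≡⟨ cong (λ x → x * 3 ^ 1 * (suc m ! * m ! * m !)) (sym (^-*-assoc 3 3 m)) ⟩
      27 ^ m * 3 ^ 1 * (suc m ! * m ! * m !)                   ≡⟨ peel m (27 ^ m) (m !) ⟩
      3 * suc m * (27 ^ m * (m ! * m ! * m !))                 ≤⟨ *-monoʳ-≤ (3 * suc m) (27^m[m!]³≤[3m]![3m+1]² m) ⟩
      3 * suc m * ((3 * m) ! * ((3 * m + 1) * (3 * m + 1)))    ≤⟨ m≤m+n _ _ ⟩
      3 * suc m * ((3 * m) ! * ((3 * m + 1) * (3 * m + 1))) + 3 * (3 * m + 1) * (24 * m * m + 32 * m + 11) * (3 * m) !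
        ≡⟨ identity m ((3 * m) !) ⟩
      (suc (3 * m) * (3 * m) !) * (9 * ((3 * m + 1 + 1) * (3 * m + 1 + 1)))
        ≡⟨ cong (λ k → k ! * (9 * ((3 * m + 1 + 1) * (3 * m + 1 + 1)))) (+-comm 1 (3 * m)) ⟩
      (3 * m + 1) ! * (9 * ((3 * m + 1 + 1) * (3 * m + 1 + 1))) ∎
      where
      peel : ∀ m y f → y * 3 ^ 1 * (suc m * f * f * f) ≡ 3 * suc m * (y * (f * f * f))
      peel = solve-∀
      identity : ∀ m G → 3 * suc m * (G * ((3 * m + 1) * (3 * m + 1))) + 3 * (3 * m + 1) * (24 * m * m + 32 * m + 11) * G
                       ≡ (suc (3 * m) * G) * (9 * ((3 * m + 1 + 1) * (3 * m + 1 + 1)))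
      identity = solve-∀
    byResidue (≡2 m) rewrite large m 2 2 refl | large m 2 1 refl | small m 2 (s≤s (s≤s (s≤s z≤n))) = begin
      3 ^ (3 * m + 2) * (suc m ! * suc m ! * m !)              ≡⟨ cong (_* (suc m ! * suc m ! * m !)) (^-distribˡ-+-* 3 (3 * m) 2) ⟩
      3 ^ (3 * m) * 3 ^ 2 * (suc m ! * suc m ! * m !)          ≡⟨ cong (λ x → x * 3 ^ 2 * (suc m ! * suc m ! * m !)) (sym (^-*-assoc 3 3 m)) ⟩
      27 ^ m * 3 ^ 2 * (suc m ! * suc m ! * m !)               ≡⟨ peel m (27 ^ m) (m !) ⟩
      9 * (suc m * suc m) * (27 ^ m * (m ! * m ! * m !))       ≤⟨ *-monoʳ-≤ (9 * (suc m * suc m)) (27^m[m!]³≤[3m]![3m+1]² m) ⟩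
      9 * (suc m * suc m) * ((3 * m) ! * ((3 * m + 1) * (3 * m + 1))) ≤⟨ m≤m+n _ _ ⟩
      9 * (suc m * suc m) * ((3 * m) ! * ((3 * m + 1) * (3 * m + 1))) + 9 * (suc m * suc m) * (3 * m + 1) * (24 * m + 17) * (3 * m) !
        ≡⟨ identity m ((3 * m) !) ⟩
      (suc (suc (3 * m)) * (suc (3 * m) * (3 * m) !)) * (9 * ((3 * m + 2 + 1) * (3 * m + 2 + 1)))
        ≡⟨ cong (λ k → k ! * (9 * ((3 * m + 2 + 1) * (3 * m + 2 + 1)))) (+-comm 2 (3 * m)) ⟩
      (3 * m + 2) ! * (9 * ((3 * m + 2 + 1) * (3 * m + 2 + 1))) ∎
      where
      peel : ∀ m y f → y * 3 ^ 2 * (suc m * f * (suc m * f) * f) ≡ 9 * (suc m * suc m) * (y * (f * f * f))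
      peel = solve-∀
      identity : ∀ m G → 9 * (suc m * suc m) * (G * ((3 * m + 1) * (3 * m + 1))) + 9 * (suc m * suc m) * (3 * m + 1) * (24 * m + 17) * G
                       ≡ (suc (suc (3 * m)) * (suc (3 * m) * G)) * (9 * ((3 * m + 2 + 1) * (3 * m + 2 + 1)))
      identity = solve-∀

  -- M(n) · A! B! D! = n!, i.e. the division defining M(n) is exact.
  M·A!B!D!≡n! : ∀ n → M n * (A n ! * B n ! * D n !) ≡ n !
  M·A!B!D!≡n! n = trans (cong (_* (A n ! * B n ! * D n !)) (M≡#balanced n))
    (#withSizes-multinomial n (A n) (B n) (D n) (floors-sum n))

  3^n≤M·9[n+1]² : ∀ n → 3 ^ n ≤ M n * (9 * ((n + 1) * (n + 1)))
  3^n≤M·9[n+1]² n = *-cancelʳ-≤ (3 ^ n) (M n * Q) P {{P≢0}} (begin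
    3 ^ n * P      ≤⟨ 3^n·A!B!D!≤n!·9[n+1]² n ⟩
    n ! * Q        ≡⟨ cong (_* Q) (sym (M·A!B!D!≡n! n)) ⟩
    M n * P * Q    ≡⟨ swap (M n) P Q ⟩
    M n * Q * P    ∎)
    where
    Q : ℕ
    Q = 9 * ((n + 1) * (n + 1))
    P : ℕ
    P = A n ! * B n ! * D n !
    swap : ∀ a b c → a * b * c ≡ a * c * b
    swap = solve-∀
    P≢0 : NonZero P
    P≢0 = m*n≢0 (A n ! * B n !) (D n !) {{m*n≢0 (A n !) (B n !) {{A n !≢0}} {{B n !≢0}}}} {{D n !≢0}}

  1≤M : ∀ n → 1 ≤ M n
  1≤M n = positive (M n) (M·A!B!D!≡n! n)
    where
    positive : ∀ k → k * (A n ! * B n ! * D n !) ≡ n ! → 1 ≤ k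
    positive zero    0≡n! = contradiction (sym 0≡n!) (≢-nonZero⁻¹ (n !) {{n !≢0}})
    positive (suc k) _    = s≤s z≤n

module Growth where

  open import Data.Nat
  open import Data.Nat.Properties
  open import Relation.Binary.PropositionalEquality
  open import Data.Product using (∃-syntax; _,_)
  open import Data.Nat.Tactic.RingSolver using (solve-∀)
  open import Data.Nat.DivMod using (_/_; /-monoˡ-≤; m*n/n≡m)
  open Thirds using (n≤3[n/3]+2)

  open ≤-Reasoning

  binomial-step : ∀ a y → suc y ^ suc a ≤ y ^ suc a + suc a * suc y ^ a
  binomial-step zero y = ≤-reflexive (linear y)
    where linear : ∀ y → suc y * 1 ≡ y * 1 + 1 * 1
          linear = solve-∀
  binomial-step (suc a) y = begin
    suc y * suc y ^ suc a                                ≤⟨ *-monoʳ-≤ (suc y) (binomial-step a y) ⟩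
    suc y * (y ^ suc a + suc a * suc y ^ a)              ≡⟨ expand (y ^ suc a) (suc y ^ a) y a ⟩
    y * (y * y ^ a) + (y ^ suc a + suc a * (suc y * suc y ^ a))
      ≤⟨ +-monoʳ-≤ (y * (y * y ^ a)) (+-monoˡ-≤ _ (^-monoˡ-≤ (suc a) (n≤1+n y))) ⟩
    y ^ suc (suc a) + (suc y ^ suc a + suc a * suc y ^ suc a) ∎
    where expand : ∀ p q y a → suc y * (p + suc a * q) ≡ y * p + (p + suc a * (suc y * q))
          expand = solve-∀

  n^a≤K2^n : ∀ a → ∃[ K ] (∀ n → n ^ a ≤ K * 2 ^ n)
  n^a≤K2^n zero = 1 , λ n → ≤-trans (m^n>0 2 n) (≤-reflexive (sym (*-identityˡ _)))
  n^a≤K2^n (suc a) with n^a≤K2^n a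
  ... | K , bound = 2 * L , λ n → ≤-trans (m≤m+n (n ^ suc a) (2 * L)) (shifted n)
    where
    L : ℕ
    L = suc a * K
    -- By induction: n^(a+1) + 2L ≤ 2L 2^n, using (n+1)^(a+1) − n^(a+1) ≤ (a+1) K 2^(n+1).
    shifted : ∀ n → n ^ suc a + 2 * L ≤ 2 * L * 2 ^ n
    shifted zero = ≤-reflexive (sym (*-identityʳ _))
    shifted (suc n) = begin
      suc n ^ suc a + 2 * L                      ≤⟨ +-monoˡ-≤ (2 * L) (binomial-step a n) ⟩
      n ^ suc a + suc a * suc n ^ a + 2 * L      ≤⟨ +-monoˡ-≤ (2 * L) (+-monoʳ-≤ (n ^ suc a) (*-monoʳ-≤ (suc a) (bound (suc n)))) ⟩
      n ^ suc a + suc a * (K * 2 ^ suc n) + 2 * L ≡⟨ regroup (n ^ suc a) (suc a) K (2 ^ n) ⟩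
      (n ^ suc a + 2 * L) + 2 * L * 2 ^ n        ≤⟨ +-monoˡ-≤ (2 * L * 2 ^ n) (shifted n) ⟩
      2 * L * 2 ^ n + 2 * L * 2 ^ n              ≡⟨ double (2 * L) (2 ^ n) ⟩
      2 * L * 2 ^ suc n                          ∎
      where regroup : ∀ p A K q → p + A * (K * (2 * q)) + 2 * (A * K) ≡ (p + 2 * (A * K)) + 2 * (A * K) * q
            regroup = solve-∀
            double : ∀ x q → x * q + x * q ≡ x * (2 * q)
            double = solve-∀

  eventually-c·n^a<2^n : ∀ a c → ∃[ N ] (∀ n → N ≤ n → c * n ^ a < 2 ^ n)
  eventually-c·n^a<2^n a c with n^a≤K2^n (suc a)
  ... | K , bound = suc (c * K) , λ n N≤n → *-cancelˡ-< n (c * n ^ a) (2 ^ n) (n-times n N≤n)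
    where
    n-times : ∀ n → suc (c * K) ≤ n → n * (c * n ^ a) < n * 2 ^ n
    n-times n N≤n = begin-strict
      n * (c * n ^ a)      ≡⟨ x*[y*z]≡y*[x*z] n c (n ^ a) ⟩
      c * (n * n ^ a)      ≤⟨ *-monoʳ-≤ c (bound n) ⟩
      c * (K * 2 ^ n)      ≡⟨ sym (*-assoc c K (2 ^ n)) ⟩
      (c * K) * 2 ^ n      <⟨ *-monoˡ-< (2 ^ n) {{m^n≢0 2 n}} N≤n ⟩
      n * 2 ^ n            ∎
      where x*[y*z]≡y*[x*z] : ∀ x y z → x * (y * z) ≡ y * (x * z)
            x*[y*z]≡y*[x*z] = solve-∀

  -- Eventually c · (n+1)^a < 2^n: apply the previous bound with 2c at n + 1.
  eventually-c·[n+1]^a<2^n : ∀ a c → ∃[ N ] (∀ n → N ≤ n → c * suc n ^ a < 2 ^ n)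
  eventually-c·[n+1]^a<2^n a c with eventually-c·n^a<2^n a (2 * c)
  ... | N , bound = N , λ n N≤n → *-cancelˡ-< 2 (c * suc n ^ a) (2 ^ n)
    (subst (_< 2 ^ suc n) (*-assoc 2 c (suc n ^ a)) (bound (suc n) (≤-trans N≤n (n≤1+n n))))

  -- Eventually c n² < 2^⌊n/3⌋: apply the previous bound to ⌊n/3⌋, using n ≤ 5⌊n/3⌋.
  eventually-c·n²<2^[n/3] : ∀ c → ∃[ N ] (∀ n → N ≤ n → c * (n * n) < 2 ^ (n / 3))
  eventually-c·n²<2^[n/3] c with eventually-c·n^a<2^n 2 (25 * c)
  ... | N , bound = suc N * 3 , eventually
    where
    N<[n/3] : ∀ n → suc N * 3 ≤ n → N < n / 3
    N<[n/3] n N≤n = subst (_≤ n / 3) (m*n/n≡m (suc N) 3) (/-monoˡ-≤ 3 N≤n)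
    -- Once ⌊n/3⌋ ≥ 1 we have n ≤ 3⌊n/3⌋ + 2 ≤ 5⌊n/3⌋.
    n≤5[n/3] : ∀ n → N < n / 3 → n ≤ 5 * (n / 3)
    n≤5[n/3] n N<D = ≤-trans (n≤3[n/3]+2 n) (≤-trans (+-monoʳ-≤ (3 * (n / 3)) (*-monoʳ-≤ 2 (≤-trans (s≤s z≤n) N<D)))
      (≤-reflexive (sum (n / 3))))
      where sum : ∀ d → 3 * d + 2 * d ≡ 5 * d
            sum = solve-∀
    square : ∀ c d → c * (5 * d * (5 * d)) ≡ 25 * c * d ^ 2
    square c d = trans (expand c d) (cong (λ e → 25 * c * (d * e)) (sym (*-identityʳ d)))
      where expand : ∀ c d → c * (5 * d * (5 * d)) ≡ 25 * c * (d * d)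
            expand = solve-∀
    eventually : ∀ n → suc N * 3 ≤ n → c * (n * n) < 2 ^ (n / 3)
    eventually n N≤n = begin-strict
      c * (n * n)                        ≤⟨ *-monoʳ-≤ c (*-mono-≤ (n≤5[n/3] n N<D) (n≤5[n/3] n N<D)) ⟩
      c * (5 * (n / 3) * (5 * (n / 3)))  ≡⟨ square c (n / 3) ⟩
      25 * c * (n / 3) ^ 2               <⟨ bound (n / 3) (<⇒≤ N<D) ⟩
      2 ^ (n / 3)                        ∎
      where N<D : N < n / 3
            N<D = N<[n/3] n N≤n

module Rationals where

  open import Data.Nat as ℕ using (ℕ; zero; suc)
  import Data.Nat.Properties as ℕ
  open import Data.Integer as ℤ using (ℤ; +_; -[1+_]; +[1+_])
  import Data.Integer.Properties as ℤ
  open import Data.Integer.Tactic.RingSolver using (solve-∀)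
  open import Data.Rational as ℚ using (ℚ; 0ℚ; mkℚ; toℚᵘ)
  import Data.Rational.Properties as ℚ
  open import Data.Rational.Unnormalised as ℚᵘ using (mkℚᵘ; *<*)
  import Data.Rational.Unnormalised.Properties as ℚᵘ
  import Data.Nat.Coprimality as Coprime
  open import Relation.Binary.PropositionalEquality

  x/1≡ : ∀ x → (+ x ℚ./ 1) ≡ mkℚ (+ x) 0 (Coprime.sym (Coprime.1-coprimeTo x))
  x/1≡ x = ℚ.normalize-coprime (Coprime.sym (Coprime.1-coprimeTo x))

  -- The integer inequality behind the rational one, for ε = (p+1)/(d+1):
  -- from (d+1) X < 6 (d+1) T + 6 X  we get  ((d+1) − 6 (p+1)) X < 6 (d+1) T.
  cross-multiplied : ∀ d p X T → suc d ℕ.* X ℕ.< 6 ℕ.* suc d ℕ.* T ℕ.+ 6 ℕ.* X →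
    (+ 1 ℤ.* + suc d ℤ.+ (ℤ.- +[1+ p ]) ℤ.* + 6) ℤ.* + X ℤ.* + 1 ℤ.< + T ℤ.* + (6 ℕ.* suc d ℕ.* 1)
  cross-multiplied d p X T hyp = subst₂ ℤ._<_ (sym lhs≡) (sym rhs≡) (move (q ℤ.* x) (+ 6 ℤ.* q ℤ.* t) (+ 6 ℤ.* pz ℤ.* x) inℤ)
    where
    q : ℤ
    q = + suc d
    pz : ℤ
    pz = + suc p
    x : ℤ
    x = + X
    t : ℤ
    t = + T
    move : ∀ a b c → a ℤ.< b ℤ.+ c → a ℤ.- c ℤ.< b
    move a b c a<b+c = subst (λ z → a ℤ.- c ℤ.< z) (cancel b c) (ℤ.+-monoˡ-< (ℤ.- c) a<b+c)
      where cancel : ∀ b c → b ℤ.+ c ℤ.- c ≡ b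
            cancel = solve-∀
    lhs≡ : (+ 1 ℤ.* q ℤ.+ (ℤ.- pz) ℤ.* + 6) ℤ.* x ℤ.* + 1 ≡ q ℤ.* x ℤ.- + 6 ℤ.* pz ℤ.* x
    lhs≡ = expand q pz x
      where expand : ∀ q p x → (+ 1 ℤ.* q ℤ.+ (ℤ.- p) ℤ.* + 6) ℤ.* x ℤ.* + 1 ≡ q ℤ.* x ℤ.- + 6 ℤ.* p ℤ.* x
            expand = solve-∀
    rhs≡ : + T ℤ.* + (6 ℕ.* suc d ℕ.* 1) ≡ + 6 ℤ.* q ℤ.* t
    rhs≡ = trans (cong (+ T ℤ.*_) (trans (ℤ.pos-* (6 ℕ.* suc d) 1) (cong (ℤ._* + 1) (ℤ.pos-* 6 (suc d))))) (reorder q t)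
      where reorder : ∀ q t → t ℤ.* (+ 6 ℤ.* q ℤ.* + 1) ≡ + 6 ℤ.* q ℤ.* t
            reorder = solve-∀
    -- ε ≥ 1/(d+1), so the hypothesis holds with 6 X replaced by 6 (p+1) X.
    inℕ : suc d ℕ.* X ℕ.< 6 ℕ.* suc d ℕ.* T ℕ.+ 6 ℕ.* suc p ℕ.* X
    inℕ = ℕ.<-≤-trans hyp (ℕ.+-monoʳ-≤ (6 ℕ.* suc d ℕ.* T) (ℕ.*-monoˡ-≤ X {6 ℕ.* 1} {6 ℕ.* suc p} (ℕ.*-monoʳ-≤ 6 {1} {suc p} (ℕ.s≤s ℕ.z≤n))))
    inℤ : q ℤ.* x ℤ.< + 6 ℤ.* q ℤ.* t ℤ.+ + 6 ℤ.* pz ℤ.* x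
    inℤ = subst₂ ℤ._<_ (ℤ.pos-* (suc d) X)
            (trans (ℤ.pos-+ (6 ℕ.* suc d ℕ.* T) (6 ℕ.* suc p ℕ.* X))
              (cong₂ ℤ._+_ (trans (ℤ.pos-* (6 ℕ.* suc d) T) (cong (ℤ._* t) (ℤ.pos-* 6 (suc d))))
                           (trans (ℤ.pos-* (6 ℕ.* suc p) X) (cong (ℤ._* x) (ℤ.pos-* 6 (suc p))))))
            (ℤ.+<+ inℕ)

  [1/6-ε]X<T : ∀ (ε : ℚ) X T → 0ℚ ℚ.< ε → ℚ.↧ₙ ε ℕ.* X ℕ.< 6 ℕ.* ℚ.↧ₙ ε ℕ.* T ℕ.+ 6 ℕ.* X →
    ((+ 1 ℚ./ 6) ℚ.- ε) ℚ.* (+ X ℚ./ 1) ℚ.< + T ℚ./ 1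
  [1/6-ε]X<T (mkℚ +[1+ p ] d c) X T _ hyp =
    ℚ.toℚᵘ-cancel-< (ℚᵘ.<-respˡ-≃ (ℚᵘ.≃-sym unnormalised) (subst (λ z → _ ℚᵘ.< toℚᵘ z) (sym (x/1≡ T)) (*<* (cross-multiplied d p X T hyp))))
    where
    ε : ℚ
    ε = mkℚ +[1+ p ] d c
    unnormalised : toℚᵘ (((+ 1 ℚ./ 6) ℚ.- ε) ℚ.* (+ X ℚ./ 1)) ℚᵘ.≃ ((mkℚᵘ (+ 1) 5 ℚᵘ.- mkℚᵘ +[1+ p ] d) ℚᵘ.* mkℚᵘ (+ X) 0)
    unnormalised = ℚᵘ.≃-trans (ℚ.toℚᵘ-homo-* ((+ 1 ℚ./ 6) ℚ.- ε) (+ X ℚ./ 1))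
      (ℚᵘ.*-cong (ℚᵘ.≃-trans (ℚ.toℚᵘ-homo-+ (+ 1 ℚ./ 6) (ℚ.- ε)) (ℚᵘ.+-cong (ℚᵘ.≃-refl {toℚᵘ (+ 1 ℚ./ 6)}) (ℚ.toℚᵘ-homo‿- ε)))
                 (ℚᵘ.≃-reflexive (cong toℚᵘ (x/1≡ X))))
  [1/6-ε]X<T (mkℚ (+ zero) d c) X T (ℚ.*<* (ℤ.+<+ ())) _
  [1/6-ε]X<T (mkℚ -[1+ n ] d c) X T (ℚ.*<* ()) _

open import Data.Nat
open import Data.Nat.Properties
open import Data.Nat.DivMod using (_/_)
open import Data.Nat.Tactic.RingSolver using (solve-∀)
open import Data.Integer using (+_)
open import Data.Rational as Q using (ℚ; 0ℚ)
open import Data.Product using (_×_; _,_; ∃-syntax)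
open import Relation.Binary.PropositionalEquality
open import Defs
open Thirds using (s-gap)
open UpperBound using (T<3^n2^s; 1≤T)
open LowerBound using (D; lower-bound)
open MultinomialBound using (3^n≤M·9[n+1]²; 1≤M)
open Growth using (eventually-c·n²<2^[n/3]; eventually-c·[n+1]^a<2^n)
open Rationals using ([1/6-ε]X<T)

open ≤-Reasoning

cleared : ∀ q n → 3 ≤ n → q * (n * n) < 2 ^ D n → q * (M n * 2 ^ s n) < 6 * q * T n + 6 * (M n * 2 ^ s n)
cleared q n 3≤n small = *-cancelˡ-< (2 ^ D n) _ _ (begin-strict
  2 ^ D n * (q * X)                          ≡⟨ x[yz]≡y[xz] (2 ^ D n) q X ⟩
  q * (2 ^ D n * X)                          ≤⟨ *-monoʳ-≤ q (lower-bound n 3≤n) ⟩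
  q * (2 ^ D n * (6 * T n) + n * n * X)      ≡⟨ spread q (2 ^ D n) (T n) (n * n) X ⟩
  2 ^ D n * (6 * q * T n) + q * (n * n) * X  <⟨ +-monoʳ-< (2 ^ D n * (6 * q * T n)) (*-monoˡ-< X {{X≢0}} small) ⟩
  2 ^ D n * (6 * q * T n) + 2 ^ D n * X      ≤⟨ +-monoʳ-≤ (2 ^ D n * (6 * q * T n)) (*-monoʳ-≤ (2 ^ D n) (m≤n*m X 6)) ⟩
  2 ^ D n * (6 * q * T n) + 2 ^ D n * (6 * X) ≡⟨ sym (*-distribˡ-+ (2 ^ D n) _ _) ⟩
  2 ^ D n * (6 * q * T n + 6 * X)            ∎)
  where
  X : ℕ
  X = M n * 2 ^ s n
  X≢0 : NonZero X
  X≢0 = >-nonZero (*-mono-≤ (1≤M n) (m^n>0 2 (s n)))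
  x[yz]≡y[xz] : ∀ x y z → x * (y * z) ≡ y * (x * z)
  x[yz]≡y[xz] = solve-∀
  spread : ∀ q p t a x → q * (p * (6 * t) + a * x) ≡ p * (6 * q * t) + q * a * x
  spread = solve-∀

lower-asymptotic : (ε : ℚ) → 0ℚ Q.< ε → ∃[ N ] ((n : ℕ) → N ≤ n →
  ((+ 1 Q./ 6) Q.- ε) Q.* (+ (M n * 2 ^ s n) Q./ 1) Q.< + T n Q./ 1)
lower-asymptotic ε ε>0 =
  let N , small = eventually-c·n²<2^[n/3] (Q.↧ₙ ε) in
  3 + N , λ n N≤n → [1/6-ε]X<T ε (M n * 2 ^ s n) (T n) ε>0
    (cleared (Q.↧ₙ ε) n (≤-trans (m≤m+n 3 N) N≤n) (small n (≤-trans (m≤n+m N 3) N≤n)))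

[xy]^k≡x^ky^k : ∀ x y k → (x * y) ^ k ≡ x ^ k * y ^ k
[xy]^k≡x^ky^k x y zero    = refl
[xy]^k≡x^ky^k x y (suc k) = trans (cong (x * y *_) ([xy]^k≡x^ky^k x y k)) (interchange x y (x ^ k) (y ^ k))
  where interchange : ∀ x y a b → x * y * (a * b) ≡ x * a * (y * b)
        interchange = solve-∀

X≤12T : ∀ n → 3 ≤ n → 2 * (n * n) ≤ 2 ^ D n → M n * 2 ^ s n ≤ 12 * T n
X≤12T n 3≤n small = *-cancelˡ-≤ (2 ^ D n) {{m^n≢0 2 (D n)}} (+-cancelʳ-≤ (2 ^ D n * X) (2 ^ D n * X) (2 ^ D n * (12 * T n)) (begin
  2 ^ D n * X + 2 ^ D n * X                ≡⟨ twice (2 ^ D n * X) ⟩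
  2 * (2 ^ D n * X)                        ≤⟨ *-monoʳ-≤ 2 (lower-bound n 3≤n) ⟩
  2 * (2 ^ D n * (6 * T n) + n * n * X)    ≡⟨ spread (2 ^ D n) (T n) (n * n) X ⟩
  2 ^ D n * (12 * T n) + 2 * (n * n) * X   ≤⟨ +-monoʳ-≤ (2 ^ D n * (12 * T n)) (*-monoˡ-≤ X small) ⟩
  2 ^ D n * (12 * T n) + 2 ^ D n * X       ∎))
  where
  X : ℕ
  X = M n * 2 ^ s n
  twice : ∀ x → x + x ≡ 2 * x
  twice = solve-∀
  spread : ∀ p t a x → 2 * (p * (6 * t) + a * x) ≡ p * (12 * t) + 2 * a * x
  spread = solve-∀

3^[n-2]≤M[n+1]² : ∀ n → 2 ≤ n → 3 ^ (n ∸ 2) ≤ M n * (suc n * suc n)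
3^[n-2]≤M[n+1]² n 2≤n = *-cancelˡ-≤ 9 (begin
  9 * 3 ^ (n ∸ 2)                   ≡⟨ sym (^-distribˡ-+-* 3 2 (n ∸ 2)) ⟩
  3 ^ (2 + (n ∸ 2))                 ≡⟨ cong (3 ^_) (m+[n∸m]≡n 2≤n) ⟩
  3 ^ n                             ≤⟨ 3^n≤M·9[n+1]² n ⟩
  M n * (9 * ((n + 1) * (n + 1)))   ≡⟨ cong (λ m → M n * (9 * (m * m))) (+-comm n 1) ⟩
  M n * (9 * P)                     ≡⟨ x[yz]≡y[xz] (M n) 9 P ⟩
  9 * (M n * P)                     ∎)
  where
  P : ℕ
  P = suc n * suc n
  x[yz]≡y[xz] : ∀ x y z → x * (y * z) ≡ y * (x * z)
  x[yz]≡y[xz] = solve-∀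

2^s-gap : ∀ n → 3 ≤ n → (2 ^ s (n ∸ 2)) ^ 9 * 2 ^ (2 * n ^ 2) ≤ (2 ^ s n) ^ 9 * 2 ^ (8 * n)
2^s-gap n 3≤n = begin
  (2 ^ s m) ^ 9 * 2 ^ (2 * n ^ 2)    ≡⟨ cong (_* 2 ^ (2 * n ^ 2)) (^-*-assoc 2 (s m) 9) ⟩
  2 ^ (s m * 9) * 2 ^ (2 * n ^ 2)    ≡⟨ sym (^-distribˡ-+-* 2 (s m * 9) (2 * n ^ 2)) ⟩
  2 ^ (s m * 9 + 2 * n ^ 2)          ≤⟨ ^-monoʳ-≤ 2 exponents ⟩
  2 ^ (s n * 9 + 8 * n)              ≡⟨ ^-distribˡ-+-* 2 (s n * 9) (8 * n) ⟩
  2 ^ (s n * 9) * 2 ^ (8 * n)        ≡⟨ cong (_* 2 ^ (8 * n)) (sym (^-*-assoc 2 (s n) 9)) ⟩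
  (2 ^ s n) ^ 9 * 2 ^ (8 * n)        ∎
  where
  m : ℕ
  m = n ∸ 2
  exponents : s m * 9 + 2 * n ^ 2 ≤ s n * 9 + 8 * n
  exponents = subst₂ _≤_ (cong₂ _+_ (*-comm 9 (s m)) (cong (2 *_) (cong (n *_) (sym (*-identityʳ n)))))
                         (cong (_+ 8 * n) (*-comm 9 (s n))) (s-gap n 3≤n)

T[n-2]-bound : ∀ n → 3 ≤ n → T (n ∸ 2) ^ 9 * 2 ^ (2 * n ^ 2) ≤ suc n ^ 18 * (M n * 2 ^ s n) ^ 9 * 2 ^ (8 * n)
T[n-2]-bound n 3≤n = begin
  T m ^ 9 * 2 ^ (2 * n ^ 2)                        ≤⟨ *-monoˡ-≤ (2 ^ (2 * n ^ 2)) (^-monoˡ-≤ 9 (<⇒≤ (T<3^n2^s m (∸-monoˡ-≤ 2 3≤n)))) ⟩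
  (3 ^ m * 2 ^ s m) ^ 9 * 2 ^ (2 * n ^ 2)          ≡⟨ cong (_* 2 ^ (2 * n ^ 2)) ([xy]^k≡x^ky^k (3 ^ m) (2 ^ s m) 9) ⟩
  (3 ^ m) ^ 9 * (2 ^ s m) ^ 9 * 2 ^ (2 * n ^ 2)    ≡⟨ *-assoc ((3 ^ m) ^ 9) _ _ ⟩
  (3 ^ m) ^ 9 * ((2 ^ s m) ^ 9 * 2 ^ (2 * n ^ 2))  ≤⟨ *-mono-≤ (^-monoˡ-≤ 9 (3^[n-2]≤M[n+1]² n (≤-trans (n≤1+n 2) 3≤n))) (2^s-gap n 3≤n) ⟩
  (M n * P) ^ 9 * ((2 ^ s n) ^ 9 * 2 ^ (8 * n))    ≡⟨ cong (_* ((2 ^ s n) ^ 9 * 2 ^ (8 * n))) ([xy]^k≡x^ky^k (M n) P 9) ⟩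
  M n ^ 9 * P ^ 9 * ((2 ^ s n) ^ 9 * 2 ^ (8 * n))  ≡⟨ regroup (M n ^ 9) (P ^ 9) ((2 ^ s n) ^ 9) (2 ^ (8 * n)) ⟩
  P ^ 9 * (M n ^ 9 * (2 ^ s n) ^ 9) * 2 ^ (8 * n)  ≡⟨ cong₂ (λ a b → a * b * 2 ^ (8 * n)) P^9≡ (sym ([xy]^k≡x^ky^k (M n) (2 ^ s n) 9)) ⟩
  suc n ^ 18 * (M n * 2 ^ s n) ^ 9 * 2 ^ (8 * n)   ∎
  where
  m : ℕ
  m = n ∸ 2
  P : ℕ
  P = suc n * suc n
  regroup : ∀ a b c d → a * b * (c * d) ≡ b * (a * c) * d
  regroup = solve-∀
  P^9≡ : P ^ 9 ≡ suc n ^ 18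
  P^9≡ = trans ([xy]^k≡x^ky^k (suc n) (suc n) 9) (sym (^-distribˡ-+-* (suc n) 9 9))

-- The constant 12^9, kept opaque so that products with it are never unfolded.
opaque
  12⁹ : ℕ
  12⁹ = 12 ^ 9

  [12t]^9≡12⁹t^9 : ∀ t → (12 * t) ^ 9 ≡ 12⁹ * t ^ 9
  [12t]^9≡12⁹t^9 t = [xy]^k≡x^ky^k 12 t 9

ratio-at : ∀ n → 3 ≤ n → 2 * (n * n) ≤ 2 ^ D n → 12⁹ * suc n ^ 18 < 2 ^ n →
  T (n ∸ 2) ^ 9 * 2 ^ (2 * n ^ 2) < n ^ 18 * 2 ^ (9 * n) * T n ^ 9
ratio-at n 3≤n small tiny = begin-strict
  T (n ∸ 2) ^ 9 * 2 ^ (2 * n ^ 2)                  ≤⟨ T[n-2]-bound n 3≤n ⟩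
  suc n ^ 18 * X ^ 9 * 2 ^ (8 * n)                 ≤⟨ *-monoˡ-≤ (2 ^ (8 * n)) (*-monoʳ-≤ (suc n ^ 18) (^-monoˡ-≤ 9 (X≤12T n 3≤n small))) ⟩
  suc n ^ 18 * (12 * T n) ^ 9 * 2 ^ (8 * n)        ≡⟨ cong (λ a → suc n ^ 18 * a * 2 ^ (8 * n)) ([12t]^9≡12⁹t^9 (T n)) ⟩
  suc n ^ 18 * (12⁹ * T n ^ 9) * 2 ^ (8 * n)       ≡⟨ regroup (suc n ^ 18) 12⁹ (T n ^ 9) (2 ^ (8 * n)) ⟩
  12⁹ * suc n ^ 18 * (T n ^ 9 * 2 ^ (8 * n))       <⟨ *-monoˡ-< (T n ^ 9 * 2 ^ (8 * n)) {{rest≢0}} tiny ⟩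
  2 ^ n * (T n ^ 9 * 2 ^ (8 * n))                  ≡⟨ collect (2 ^ n) (T n ^ 9) (2 ^ (8 * n)) ⟩
  2 ^ n * 2 ^ (8 * n) * T n ^ 9                    ≡⟨ cong (_* T n ^ 9) (sym (trans (cong (2 ^_) (nine n)) (^-distribˡ-+-* 2 n (8 * n)))) ⟩
  2 ^ (9 * n) * T n ^ 9                            ≤⟨ m≤n*m (2 ^ (9 * n) * T n ^ 9) (n ^ 18) {{n^18≢0}} ⟩
  n ^ 18 * (2 ^ (9 * n) * T n ^ 9)                 ≡⟨ sym (*-assoc (n ^ 18) _ _) ⟩
  n ^ 18 * 2 ^ (9 * n) * T n ^ 9                   ∎
  where
  X : ℕ
  X = M n * 2 ^ s n
  rest≢0 : NonZero (T n ^ 9 * 2 ^ (8 * n))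
  rest≢0 = >-nonZero (*-mono-≤ (^-monoˡ-≤ 9 (1≤T n)) (m^n>0 2 (8 * n)))
  n^18≢0 : NonZero (n ^ 18)
  n^18≢0 = m^n≢0 n 18 {{>-nonZero (≤-trans (s≤s z≤n) 3≤n)}}
  regroup : ∀ a b t e → a * (b * t) * e ≡ b * a * (t * e)
  regroup = solve-∀
  collect : ∀ a t e → a * (t * e) ≡ a * e * t
  collect = solve-∀
  nine : ∀ n → 9 * n ≡ n + 8 * n
  nine = solve-∀

ratio-bound : ∃[ N ] ((n : ℕ) → N ≤ n → T (n ∸ 2) ^ 9 * 2 ^ (2 * n ^ 2) < n ^ 18 * 2 ^ (9 * n) * T n ^ 9)
ratio-bound = combine (eventually-c·n²<2^[n/3] 2) (eventually-c·[n+1]^a<2^n 18 12⁹)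
  where
  combine : ∃[ N₁ ] (∀ n → N₁ ≤ n → 2 * (n * n) < 2 ^ (n / 3)) →
            ∃[ N₂ ] (∀ n → N₂ ≤ n → 12⁹ * suc n ^ 18 < 2 ^ n) →
            ∃[ N ] ((n : ℕ) → N ≤ n → T (n ∸ 2) ^ 9 * 2 ^ (2 * n ^ 2) < n ^ 18 * 2 ^ (9 * n) * T n ^ 9)
  combine (N₁ , small) (N₂ , tiny) = 3 + N₁ + N₂ , λ n N≤n →
    ratio-at n (≤-trans (≤-trans (m≤m+n 3 N₁) (m≤m+n (3 + N₁) N₂)) N≤n)
      (<⇒≤ (small n (≤-trans (≤-trans (m≤n+m N₁ 3) (m≤m+n (3 + N₁) N₂)) N≤n)))
      (tiny n (≤-trans (m≤n+m N₂ (3 + N₁)) N≤n))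

lemma5 :
    ((ε : ℚ) → 0ℚ Q.< ε → ∃[ N ] ((n : ℕ) → N ≤ n →
        ((+ 1 Q./ 6) Q.- ε) Q.* (+ (M n * 2 ^ s n) Q./ 1) Q.< + T n Q./ 1))
    × (∃[ N ] ((n : ℕ) → N ≤ n → T n < 3 ^ n * 2 ^ s n))
    × (∃[ N ] ((n : ℕ) → N ≤ n →
        T (n ∸ 2) ^ 9 * 2 ^ (2 * n ^ 2) < n ^ 18 * 2 ^ (9 * n) * T n ^ 9))
lemma5 = lower-asymptotic , (1 , T<3^n2^s) , ratio-bound
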